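{- Let $G=(V,E)$ be a finite connected simple graph with $n$ vertices. (1) For positive integers $c$ and $k$: $\gamma_{ck}(G)\leq c\gamma_k(G)$ and $\gamma_{ck}^s(G)\leq c\gamma_k^s(G)$. (2) For positive integers $c,k$ and every $\gamma_k(G)$-function $f=(V_0,\dots,V_k)$, with $A_k=\lfloor k/2\rfloor$, $$\gamma_{ck+1}(G)\leq c\gamma_k(G)+\sum_{0\leq i\leq A_k}|V_i|\leq c\gamma_k(G)+|V|.$$ (3) For positive integers $c,k$ and every $\gamma_k^s(G)$-function $f=(V_0,\dots,V_k)$, $$\gamma_{ck+1}^s(G)\leq c\gamma_k^s(G)+|V|-|V_0|\leq (c+1)\gamma_k^s(G).$$ (4) Suppose $n\geq 3$ and $k\geq 2$. If $k$ is even, then $\gamma_k(G)\leq 3kn/8$ and $\gamma_k^s(G)\leq 2kn/5$; if $k$ is odd, then $\gamma_k(G)\leq (3k+5)n/8$ and $\gamma_k^s(G)\leq 2(k+1)n/5$.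
   Context: For a positive integer $k$ and $f:V\to\{0,1,\dots,k\}$, write $V_i=\{v\in V: f(v)=i\}$, $f=(V_0,\dots,V_k)$, and $w(f)=\sum_{v\in V}f(v)$. $f$ is a Roman $k$-dominating function ($k$-RDF) if every $u$ with $f(u)<k/2$ satisfies $\sum_{v\in N_G[u]}f(v)\geq k$ (closed neighbourhood); it is a strong Roman $k$-dominating function ($k$-SRDF) if every $u$ with $f(u)<k/2$ satisfies $f(u)+\sum_{v\in N_G(u),\, f(v)>k/2}f(v)\geq k$ (open neighbourhood). $\gamma_k(G)$ (resp. $\gamma_k^s(G)$) is the minimum weight of a $k$-RDF (resp. $k$-SRDF); a $\gamma_k(G)$-function (resp. $\gamma_k^s(G)$-function) is a $k$-RDF (resp. $k$-SRDF) attaining this minimum. -}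

module Defs where

open import Data.Nat using (ℕ; zero; suc; _+_; _*_; _≤_; _<_; _/_; _<ᵇ_; _≡ᵇ_)
open import Data.Fin using (Fin; zero; suc)
open import Data.Bool using (Bool; true; false; if_then_else_; _∧_)
open import Data.Product using (_×_)
open import Relation.Binary.PropositionalEquality using (_≡_)

sumFin : ∀ {n} → (Fin n → ℕ) → ℕ
sumFin {zero}  h = 0
sumFin {suc n} h = h zero + sumFin (λ i → h (suc i))

sumRange : ℕ → (ℕ → ℕ) → ℕ
sumRange zero    h = 0
sumRange (suc m) h = sumRange m h + h m

record SimpleGraph (n : ℕ) : Set where
  field
    adj    : Fin n → Fin n → Bool
    sym    : ∀ u v → adj u v ≡ adj v u
    irrefl : ∀ v → adj v v ≡ false
open SimpleGraph public

data Reach {n : ℕ} (G : SimpleGraph n) : Fin n → Fin n → Set where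
  here : ∀ {u} → Reach G u u
  step : ∀ {u v w} → adj G u v ≡ true → Reach G v w → Reach G u w

Connected : ∀ {n} → SimpleGraph n → Set
Connected G = ∀ u v → Reach G u v

weight : ∀ {n} → (Fin n → ℕ) → ℕ
weight f = sumFin f

cardV : ∀ {n} → (Fin n → ℕ) → ℕ → ℕ
cardV f i = sumFin (λ v → if f v ≡ᵇ i then 1 else 0)

IsRDF : ∀ {n} → ℕ → SimpleGraph n → (Fin n → ℕ) → Set
IsRDF k G f =
  (∀ v → f v ≤ k) ×
  (∀ u → 2 * f u < k →
     k ≤ f u + sumFin (λ v → if adj G u v then f v else 0))

IsSRDF : ∀ {n} → ℕ → SimpleGraph n → (Fin n → ℕ) → Set
IsSRDF k G f =
  (∀ v → f v ≤ k) ×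
  (∀ u → 2 * f u < k →
     k ≤ f u + sumFin (λ v → if adj G u v ∧ (k <ᵇ 2 * f v) then f v else 0))

-- γ_k(G)-function: a k-RDF of minimum weight (so weight f = γ_k(G)).
IsGammaFun : ∀ {n} → ℕ → SimpleGraph n → (Fin n → ℕ) → Set
IsGammaFun k G f = IsRDF k G f × (∀ g → IsRDF k G g → weight f ≤ weight g)

IsGammaSFun : ∀ {n} → ℕ → SimpleGraph n → (Fin n → ℕ) → Set
IsGammaSFun k G f = IsSRDF k G f × (∀ g → IsSRDF k G g → weight f ≤ weight g)

{-# OPTIONS --safe #-}
module Submission where

-- If f is a k-RDF (k-SRDF), then c·f is a ck-RDF (ck-SRDF). Adding 1 to c·f on
-- V₀ ∪ … ∪ V_⌊k/2⌋ gives a (ck+1)-RDF, and adding 1 on the vertices where f is positive gives a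
-- (ck+1)-SRDF; comparing with γ-functions yields the inequalities.
--
-- By (1)–(3) with k = 2 it suffices to show γ₂(G) ≤ 3n/4 and γ₂ˢ(G) ≤ 4n/5. Call a vertex of
-- degree 2 with exactly one leaf neighbour a stem. Deleting edges whose ends are non-leaf non-stems,
-- as long as there are any, keeps the graph free of isolated vertices and of K₂ components, and ends
-- in a spanning subgraph where every edge between non-leaves meets a stem. There, 2 on every
-- non-leaf non-stem and on one stem of each adjacent pair of stems, plus 1 on the leaves that
-- still lack such a neighbour, is a strong Roman 2-function. Let every leaf send 4 to a neighbour
-- valued 2 and every stem valued 0 send 1 to its leaf and 3 to its other neighbour; then every
-- vertex v satisfies 5 f(v) + sent(v) ≤ 4 + received(v), and summing over v gives 5 w(f) ≤ 4n.
-- The Italian 2-function (1 instead of 2 on non-stems without leaf neighbours) is handled in the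
-- same way with 4 f(v) + sent(v) ≤ 3 + received(v).

open import Defs hiding (sym; irrefl)
open import Data.Bool using (Bool; true; false; if_then_else_; _∧_; _∨_; not; T)
open import Data.Bool.Properties
  using (T-≡; ∧-comm; ∧-conicalˡ; ∧-conicalʳ; ∧-identityʳ; ∧-zeroʳ; ∨-zeroʳ; not-injective)
  renaming (_≟_ to _≟ᵇ_)
open import Data.Empty using (⊥; ⊥-elim)
open import Data.Fin using (Fin; zero; suc; toℕ) renaming (_≟_ to _≟ᶠ_)
open import Data.Fin.Properties using (toℕ-injective; any?) renaming (suc-injective to suc-injectiveᶠ)
open import Data.Nat
open import Data.Nat.DivMod using (m≡m%n+[m/n]*n; m%n<n; m*n/n≡m; /-monoˡ-≤)
open import Data.Nat.Divisibility using (_∣_; divides)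
open import Data.Nat.Induction using (<-wellFounded)
open import Data.Nat.Properties
open import Data.Nat.Tactic.RingSolver using (solve-∀)
open import Algebra.Properties.CommutativeMonoid.Sum +-0-commutativeMonoid
  using (sum; sum-cong-≗; ∑-distrib-+; ∑-comm)
open import Data.Product using (∃; ∃₂; _×_; _,_; proj₁; proj₂)
open import Data.Sum using (_⊎_; inj₁; inj₂; swap)
open import Function using (_∘_; mk⇔; Equivalence)
open import Induction.WellFounded using (Acc; acc)
open import Relation.Binary.Definitions using (tri<; tri≈; tri>)
open import Relation.Binary.PropositionalEquality
open import Relation.Nullary using (¬_; yes; no; does; contradiction)
open import Relation.Nullary.Decidable using (does-⇔; dec-true; dec-false)

<ᵇ≡true⇒< : ∀ {m n} → (m <ᵇ n) ≡ true → m < n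
<ᵇ≡true⇒< {m} {n} e = <ᵇ⇒< m n (Equivalence.from T-≡ e)

<⇒<ᵇ≡true : ∀ {m n} → m < n → (m <ᵇ n) ≡ true
<⇒<ᵇ≡true m<n = Equivalence.to T-≡ (<⇒<ᵇ m<n)

<ᵇ≡false⇒≥ : ∀ {m n} → (m <ᵇ n) ≡ false → n ≤ m
<ᵇ≡false⇒≥ {m} {n} e = ≮⇒≥ λ m<n → subst T e (<⇒<ᵇ m<n)

≡ᵇ≡true⇒≡ : ∀ {m n} → (m ≡ᵇ n) ≡ true → m ≡ n
≡ᵇ≡true⇒≡ {m} {n} e = ≡ᵇ⇒≡ m n (Equivalence.from T-≡ e)

≡⇒≡ᵇ≡true : ∀ {m n} → m ≡ n → (m ≡ᵇ n) ≡ true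
≡⇒≡ᵇ≡true {m} {n} m≡n = Equivalence.to T-≡ (≡⇒≡ᵇ m n m≡n)

true-or-false : ∀ b → b ≡ true ⊎ b ≡ false
true-or-false true  = inj₁ refl
true-or-false false = inj₂ refl

both-true-false : ∀ {b} → b ≡ true → b ≡ false → ⊥
both-true-false refl ()

<ᵇ-*-cancelˡ : ∀ c m n .{{_ : NonZero c}} → (c * m <ᵇ c * n) ≡ (m <ᵇ n)
<ᵇ-*-cancelˡ c m n = does-⇔ (mk⇔ (*-cancelˡ-< c m n) (*-monoʳ-< c)) (c * m <? c * n) (m <? n)

indicator-≤1 : ∀ b → (if b then 1 else 0) ≤ 1
indicator-≤1 true  = ≤-refl
indicator-≤1 false = z≤n

2*x<2⇒x≡0 : ∀ {x} → 2 * x < 2 → x ≡ 0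
2*x<2⇒x≡0 {x} lt = n<1⇒n≡0 (*-cancelˡ-< 2 x 1 lt)

3l+2i≥5 : ∀ {l i} → 1 ≤ l → 2 ≤ l + i → ¬ (l ≡ 1 × i ≡ 1) → 5 ≤ 3 * l + 2 * i
3l+2i≥5 {1}           {0}           _ (s≤s ()) _
3l+2i≥5 {1}           {1}           _ _        not-both = contradiction (refl , refl) not-both
3l+2i≥5 {1}           {suc (suc i)} _ _        _ = s≤s (s≤s (s≤s (s≤s (s≤s z≤n))))
3l+2i≥5 {suc (suc l)} {i}           _ _        _ = begin
  5                     ≤⟨ n≤1+n 5 ⟩
  3 * 2                 ≤⟨ *-monoʳ-≤ 3 (s≤s (s≤s (z≤n {l}))) ⟩
  3 * suc (suc l)       ≤⟨ m≤m+n _ (2 * i) ⟩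
  3 * suc (suc l) + 2 * i ∎
  where open ≤-Reasoning

-- Sums over Fin n

sumFin≡sum : ∀ {n} (h : Fin n → ℕ) → sumFin h ≡ sum h
sumFin≡sum {zero}  h = refl
sumFin≡sum {suc n} h = cong (h zero +_) (sumFin≡sum (h ∘ suc))

sumFin-cong : ∀ {n} {f g : Fin n → ℕ} → (∀ v → f v ≡ g v) → sumFin f ≡ sumFin g
sumFin-cong {zero}  f≗g = refl
sumFin-cong {suc n} f≗g = cong₂ _+_ (f≗g zero) (sumFin-cong (f≗g ∘ suc))

sumFin-mono : ∀ {n} {f g : Fin n → ℕ} → (∀ v → f v ≤ g v) → sumFin f ≤ sumFin g
sumFin-mono {zero}  f≤g = z≤n
sumFin-mono {suc n} f≤g = +-mono-≤ (f≤g zero) (sumFin-mono (f≤g ∘ suc))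

sumFin-mono-< : ∀ {n} {f g : Fin n → ℕ} → (∀ v → f v ≤ g v) → ∀ a → f a < g a →
                sumFin f < sumFin g
sumFin-mono-< f≤g zero    lt = +-mono-<-≤ lt (sumFin-mono (f≤g ∘ suc))
sumFin-mono-< f≤g (suc a) lt = +-mono-≤-< (f≤g zero) (sumFin-mono-< (f≤g ∘ suc) a lt)

sumFin-distrib-+ : ∀ {n} (f g : Fin n → ℕ) →
                   sumFin (λ v → f v + g v) ≡ sumFin f + sumFin g
sumFin-distrib-+ f g = begin
  sumFin (λ v → f v + g v) ≡⟨ sumFin≡sum (λ v → f v + g v) ⟩
  sum (λ v → f v + g v)    ≡⟨ ∑-distrib-+ f g ⟩
  sum f + sum g            ≡⟨ sym (cong₂ _+_ (sumFin≡sum f) (sumFin≡sum g)) ⟩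
  sumFin f + sumFin g      ∎
  where open ≡-Reasoning

sumFin-comm : ∀ {m n} (h : Fin m → Fin n → ℕ) →
              sumFin (λ u → sumFin (h u)) ≡ sumFin (λ v → sumFin (λ u → h u v))
sumFin-comm h = begin
  sumFin (λ u → sumFin (h u))           ≡⟨ sumFin≡sum₂ h ⟩
  sum (λ u → sum (h u))                 ≡⟨ ∑-comm h ⟩
  sum (λ v → sum (λ u → h u v))         ≡⟨ sym (sumFin≡sum₂ (λ v u → h u v)) ⟩
  sumFin (λ v → sumFin (λ u → h u v))   ∎
  where
  open ≡-Reasoning
  sumFin≡sum₂ : ∀ {m n} (h : Fin m → Fin n → ℕ) →
                sumFin (λ u → sumFin (h u)) ≡ sum (λ u → sum (h u))
  sumFin≡sum₂ h = trans (sumFin≡sum (λ u → sumFin (h u))) (sum-cong-≗ (λ u → sumFin≡sum (h u)))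

sumFin-*ˡ : ∀ {n} c (f : Fin n → ℕ) → sumFin (λ v → c * f v) ≡ c * sumFin f
sumFin-*ˡ {zero}  c f = sym (*-zeroʳ c)
sumFin-*ˡ {suc n} c f = begin
  c * f zero + sumFin (λ v → c * f (suc v)) ≡⟨ cong (c * f zero +_) (sumFin-*ˡ c (f ∘ suc)) ⟩
  c * f zero + c * sumFin (f ∘ suc)         ≡⟨ sym (*-distribˡ-+ c (f zero) _) ⟩
  c * sumFin f                              ∎
  where open ≡-Reasoning

sumFin-const : ∀ n c → sumFin {n} (λ _ → c) ≡ n * c
sumFin-const zero    c = refl
sumFin-const (suc n) c = cong (c +_) (sumFin-const n c)

sumFin-≥-term : ∀ {n} (f : Fin n → ℕ) a → f a ≤ sumFin f
sumFin-≥-term f zero    = m≤m+n _ _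
sumFin-≥-term f (suc a) = ≤-trans (sumFin-≥-term (f ∘ suc) a) (m≤n+m _ (f zero))

sumFin-≥-two-terms : ∀ {n} (f : Fin n → ℕ) {a b} → a ≢ b → f a + f b ≤ sumFin f
sumFin-≥-two-terms f {zero}  {zero}  a≢b = contradiction refl a≢b
sumFin-≥-two-terms f {zero}  {suc b} a≢b = +-monoʳ-≤ (f zero) (sumFin-≥-term (f ∘ suc) b)
sumFin-≥-two-terms f {suc a} {zero}  a≢b = begin
  f (suc a) + f zero ≡⟨ +-comm (f (suc a)) (f zero) ⟩
  f zero + f (suc a) ≤⟨ +-monoʳ-≤ (f zero) (sumFin-≥-term (f ∘ suc) a) ⟩
  sumFin f           ∎
  where open ≤-Reasoning
sumFin-≥-two-terms f {suc a} {suc b} a≢b =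
  ≤-trans (sumFin-≥-two-terms (f ∘ suc) (a≢b ∘ cong suc)) (m≤n+m _ (f zero))

sumFin-update : ∀ {n} (f g : Fin n → ℕ) a → (∀ v → v ≢ a → f v ≡ g v) →
                sumFin f + g a ≡ sumFin g + f a
sumFin-update f g zero agree = begin
  f zero + sumFin (f ∘ suc) + g zero
    ≡⟨ cong (λ s → f zero + s + g zero) (sumFin-cong (λ v → agree (suc v) λ ())) ⟩
  f zero + sumFin (g ∘ suc) + g zero ≡⟨ x+s+y≡y+s+x (f zero) _ (g zero) ⟩
  g zero + sumFin (g ∘ suc) + f zero ∎
  where
  open ≡-Reasoning
  x+s+y≡y+s+x : ∀ x s y → x + s + y ≡ y + s + x
  x+s+y≡y+s+x = solve-∀
sumFin-update f g (suc a) agree = begin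
  f zero + sumFin (f ∘ suc) + g (suc a)   ≡⟨ +-assoc (f zero) _ _ ⟩
  f zero + (sumFin (f ∘ suc) + g (suc a))
    ≡⟨ cong₂ _+_ (agree zero λ ())
                 (sumFin-update (f ∘ suc) (g ∘ suc) a λ v v≢a → agree (suc v) (v≢a ∘ suc-injectiveᶠ)) ⟩
  g zero + (sumFin (g ∘ suc) + f (suc a)) ≡⟨ +-assoc (g zero) _ _ ⟨
  g zero + sumFin (g ∘ suc) + f (suc a)   ∎
  where open ≡-Reasoning

sumFin-pos : ∀ {n} (f : Fin n → ℕ) → 0 < sumFin f → ∃ λ v → 0 < f v
sumFin-pos {suc n} f pos with f zero in f0
... | suc _ = zero , subst (0 <_) (sym f0) z<s
... | zero with sumFin-pos (f ∘ suc) pos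
...   | v , fv>0 = suc v , fv>0

sumOver : ∀ {n} → (Fin n → Bool) → (Fin n → ℕ) → ℕ
sumOver p f = sumFin (λ v → if p v then f v else 0)

count : ∀ {n} → (Fin n → Bool) → ℕ
count p = sumOver p (λ _ → 1)

module _ {n : ℕ} where

  sumOver-mono : ∀ (p : Fin n → Bool) {f g} → (∀ v → p v ≡ true → f v ≤ g v) →
                 sumOver p f ≤ sumOver p g
  sumOver-mono p f≤g = sumFin-mono pointwise
    where
    pointwise : ∀ v → (if p v then _ else 0) ≤ (if p v then _ else 0)
    pointwise v with p v in pv
    ... | true  = f≤g v pv
    ... | false = z≤n

  sumOver-⊆ : ∀ {p q : Fin n → Bool} f → (∀ v → p v ≡ true → q v ≡ true) →
              sumOver p f ≤ sumOver q f
  sumOver-⊆ {p} {q} f p⊆q = sumFin-mono pointwise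
    where
    pointwise : ∀ v → (if p v then f v else 0) ≤ (if q v then f v else 0)
    pointwise v with p v in pv
    ... | true  rewrite p⊆q v pv = ≤-refl
    ... | false = z≤n

  sumOver-*ˡ : ∀ (p : Fin n → Bool) c f → sumOver p (λ v → c * f v) ≡ c * sumOver p f
  sumOver-*ˡ p c f = trans (sumFin-cong pointwise) (sumFin-*ˡ {n} c _)
    where
    pointwise : ∀ v → (if p v then c * f v else 0) ≡ c * (if p v then f v else 0)
    pointwise v with p v
    ... | true  = refl
    ... | false = sym (*-zeroʳ c)

  sumOver-const : ∀ (p : Fin n → Bool) c → sumOver p (λ _ → c) ≡ c * count p
  sumOver-const p c = trans (sumFin-cong pointwise) (sumOver-*ˡ p c (λ _ → 1))
    where
    pointwise : ∀ v → (if p v then c else 0) ≡ (if p v then c * 1 else 0)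
    pointwise v = cong (λ x → if p v then x else 0) (sym (*-identityʳ c))

  sumOver-≤ : ∀ (p : Fin n → Bool) {f} c → (∀ v → p v ≡ true → f v ≤ c) →
              sumOver p f ≤ c * count p
  sumOver-≤ p c f≤c = ≤-trans (sumOver-mono p f≤c) (≤-reflexive (sumOver-const p c))

  sumOver-≥ : ∀ (p : Fin n → Bool) {f} c → (∀ v → p v ≡ true → c ≤ f v) →
              c * count p ≤ sumOver p f
  sumOver-≥ p c c≤f = ≤-trans (≤-reflexive (sym (sumOver-const p c))) (sumOver-mono p c≤f)

  sumOver-≥-term : ∀ (p : Fin n → Bool) f {a} → p a ≡ true → f a ≤ sumOver p f
  sumOver-≥-term p f {a} pa = subst (_≤ sumOver p f) (cong (λ b → if b then f a else 0) pa)
                                    (sumFin-≥-term _ a)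

  sumOver-split : ∀ (p q : Fin n → Bool) f →
    sumOver p f ≡ sumOver (λ v → p v ∧ q v) f + sumOver (λ v → p v ∧ not (q v)) f
  sumOver-split p q f = trans (sumFin-cong pointwise) (sumFin-distrib-+ {n} _ _)
    where
    pointwise : ∀ v → (if p v then f v else 0) ≡
                (if p v ∧ q v then f v else 0) + (if p v ∧ not (q v) then f v else 0)
    pointwise v with p v | q v
    ... | true  | true  = sym (+-identityʳ (f v))
    ... | true  | false = refl
    ... | false | _     = refl

  count-≤ : ∀ (p : Fin n → Bool) → count p ≤ n
  count-≤ p = ≤-trans (sumFin-mono (indicator-≤1 ∘ p)) (≤-reflexive (trans (sumFin-const n 1) (*-identityʳ n)))

  count-witness : ∀ (p : Fin n → Bool) → 0 < count p → ∃ λ v → p v ≡ true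
  count-witness p pos = search (sumFin-pos (λ v → if p v then 1 else 0) pos)
    where
    search : (∃ λ v → 0 < (if p v then 1 else 0)) → ∃ λ v → p v ≡ true
    search (v , _) with p v in pv
    search (v , _)     | true = v , pv
    search (v , ())    | false

  sumOver-≥-two-terms : ∀ (p : Fin n → Bool) f {a b} → a ≢ b → p a ≡ true → p b ≡ true →
                        f a + f b ≤ sumOver p f
  sumOver-≥-two-terms p f {a} {b} a≢b pa pb =
    subst (_≤ sumOver p f) (cong₂ (λ x y → (if x then f a else 0) + (if y then f b else 0)) pa pb)
          (sumFin-≥-two-terms (λ v → if p v then f v else 0) a≢b)

  count-unique : ∀ (p : Fin n → Bool) {a b} → count p ≡ 1 → p a ≡ true → p b ≡ true → a ≡ b
  count-unique p {a} {b} one pa pb with a ≟ᶠ b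
  ... | yes a≡b = a≡b
  ... | no  a≢b = contradiction (subst (2 ≤_) one (sumOver-≥-two-terms p (λ _ → 1) a≢b pa pb)) λ { (s≤s ()) }

  sumOver-distrib-+ : ∀ (p : Fin n → Bool) f g →
                      sumOver p (λ v → f v + g v) ≡ sumOver p f + sumOver p g
  sumOver-distrib-+ p f g = trans (sumFin-cong pointwise) (sumFin-distrib-+ {n} _ _)
    where
    pointwise : ∀ v → (if p v then f v + g v else 0) ≡ (if p v then f v else 0) + (if p v then g v else 0)
    pointwise v with p v
    ... | true  = refl
    ... | false = refl

  count-≥1 : ∀ (p : Fin n → Bool) {a} → p a ≡ true → 1 ≤ count p
  count-≥1 p = sumOver-≥-term p (λ _ → 1)

-- Scaling and lifting dominating functions

half<⇒<double : ∀ {k x} → k / 2 < x → k < 2 * x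
half<⇒<double {k} {x} half<x = ≰⇒> λ 2x≤k →
  <⇒≱ half<x (subst (_≤ k / 2) (trans (cong (_/ 2) (*-comm 2 x)) (m*n/n≡m x 2)) (/-monoˡ-≤ 2 2x≤k))

2[cx]≡c[2x] : ∀ c x → 2 * (c * x) ≡ c * (2 * x)
2[cx]≡c[2x] = solve-∀

halve-scaled : ∀ {c x k} → 2 * (c * x) < c * k → 2 * x < k
halve-scaled {c} {x} {k} small = *-cancelˡ-< c (2 * x) k (subst (_< c * k) (2[cx]≡c[2x] c x) small)

c[2x]+2≡2[cx+1] : ∀ c x → c * (2 * x) + 2 ≡ 2 * (c * x + 1)
c[2x]+2≡2[cx+1] = solve-∀

c[x+s]+1≡[cx+1]+cs : ∀ c x s → c * (x + s) + 1 ≡ (c * x + 1) + c * s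
c[x+s]+1≡[cx+1]+cs = solve-∀

liftSmall : ∀ {n} → ℕ → ℕ → (Fin n → ℕ) → Fin n → ℕ
liftSmall c k f v = c * f v + (if f v <ᵇ suc (k / 2) then 1 else 0)

liftPositive : ∀ {n} → ℕ → (Fin n → ℕ) → Fin n → ℕ
liftPositive c f v = c * f v + (if 0 <ᵇ f v then 1 else 0)

module _ {n : ℕ} (G : SimpleGraph n) where

  nbrSum : (Fin n → ℕ) → Fin n → ℕ
  nbrSum f u = sumOver (adj G u) f

  strongNbr : ℕ → (Fin n → ℕ) → Fin n → Fin n → Bool
  strongNbr k f u v = adj G u v ∧ (k <ᵇ 2 * f v)

  strongNbrSum : ℕ → (Fin n → ℕ) → Fin n → ℕ
  strongNbrSum k f u = sumOver (strongNbr k f u) f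

  scale-RDF : ∀ c {k f} → IsRDF k G f → IsRDF (c * k) G (λ v → c * f v)
  scale-RDF c {k} {f} (f≤k , dom) = (λ v → *-monoʳ-≤ c (f≤k v)) , dom′
    where
    dom′ : ∀ u → 2 * (c * f u) < c * k → c * k ≤ c * f u + nbrSum (λ v → c * f v) u
    dom′ u small = begin
      c * k                     ≤⟨ *-monoʳ-≤ c (dom u (halve-scaled {c} {f u} small)) ⟩
      c * (f u + nbrSum f u)    ≡⟨ *-distribˡ-+ c (f u) _ ⟩
      c * f u + c * nbrSum f u  ≡⟨ cong (c * f u +_) (sym (sumOver-*ˡ (adj G u) c f)) ⟩
      c * f u + nbrSum (λ v → c * f v) u ∎
      where open ≤-Reasoning

  strongNbrSum-scale : ∀ c .{{_ : NonZero c}} k f u →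
    strongNbrSum (c * k) (λ v → c * f v) u ≡ c * strongNbrSum k f u
  strongNbrSum-scale c k f u = trans (sumFin-cong pointwise) (sumOver-*ˡ _ c f)
    where
    pointwise : ∀ v → (if adj G u v ∧ (c * k <ᵇ 2 * (c * f v)) then c * f v else 0) ≡
                      (if adj G u v ∧ (k <ᵇ 2 * f v) then c * f v else 0)
    pointwise v = cong (λ b → if adj G u v ∧ b then c * f v else 0)
      (trans (cong (c * k <ᵇ_) (2[cx]≡c[2x] c (f v))) (<ᵇ-*-cancelˡ c k (2 * f v)))

  scale-SRDF : ∀ c {k f} → IsSRDF k G f → IsSRDF (c * k) G (λ v → c * f v)
  scale-SRDF zero          _           = (λ _ → z≤n) , λ _ ()
  scale-SRDF c@(suc _) {k} {f} (f≤k , dom) = (λ v → *-monoʳ-≤ c (f≤k v)) , dom′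
    where
    dom′ : ∀ u → 2 * (c * f u) < c * k → c * k ≤ c * f u + strongNbrSum (c * k) (λ v → c * f v) u
    dom′ u small = begin
      c * k                            ≤⟨ *-monoʳ-≤ c (dom u (halve-scaled {c} {f u} small)) ⟩
      c * (f u + strongNbrSum k f u)   ≡⟨ *-distribˡ-+ c (f u) _ ⟩
      c * f u + c * strongNbrSum k f u ≡⟨ cong (c * f u +_) (sym (strongNbrSum-scale c k f u)) ⟩
      c * f u + strongNbrSum (c * k) (λ v → c * f v) u ∎
      where open ≤-Reasoning

  liftSmall-RDF : ∀ {c k f} → 1 ≤ c → IsRDF k G f → IsRDF (c * k + 1) G (liftSmall c k f)
  liftSmall-RDF {c} {k} {f} c≥1 (f≤k , dom) = g≤ , dom′
    where
    g : Fin n → ℕ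
    g = liftSmall c k f
    g≤ : ∀ v → g v ≤ c * k + 1
    g≤ v = +-mono-≤ (*-monoʳ-≤ c (f≤k v)) (indicator-≤1 _)
    cf≤g : ∀ v → c * f v ≤ g v
    cf≤g v = m≤m+n (c * f v) _
    nbrSum-lift : ∀ u → c * nbrSum f u ≤ nbrSum g u
    nbrSum-lift u = ≤-trans (≤-reflexive (sym (sumOver-*ˡ (adj G u) c f)))
                            (sumOver-mono (adj G u) (λ v _ → cf≤g v))
    dom′ : ∀ u → 2 * g u < c * k + 1 → c * k + 1 ≤ g u + nbrSum g u
    dom′ u small with f u <ᵇ suc (k / 2) in low
    ... | false = contradiction small (≤⇒≯ (begin
      c * k + 1      ≤⟨ +-monoʳ-≤ (c * k) c≥1 ⟩
      c * k + c      ≡⟨ +-comm (c * k) c ⟩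
      c + c * k      ≡⟨ *-suc c k ⟨
      c * suc k      ≤⟨ *-monoʳ-≤ c (half<⇒<double {k} {f u} (<ᵇ≡false⇒≥ low)) ⟩
      c * (2 * f u)  ≡⟨ 2[cx]≡c[2x] c (f u) ⟨
      2 * (c * f u)  ≡⟨ cong (2 *_) (+-identityʳ (c * f u)) ⟨
      2 * (c * f u + 0) ∎))
      where open ≤-Reasoning
    ... | true with 2 * f u <? k
    ...   | yes 2fu<k = begin
      c * k + 1                       ≤⟨ +-monoˡ-≤ 1 (*-monoʳ-≤ c (dom u 2fu<k)) ⟩
      c * (f u + nbrSum f u) + 1      ≡⟨ c[x+s]+1≡[cx+1]+cs c (f u) (nbrSum f u) ⟩
      (c * f u + 1) + c * nbrSum f u  ≤⟨ +-monoʳ-≤ (c * f u + 1) (nbrSum-lift u) ⟩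
      (c * f u + 1) + nbrSum g u      ∎
      where open ≤-Reasoning
    ...   | no 2fu≮k = contradiction small (≤⇒≯ (begin
      c * k + 1          ≤⟨ +-monoʳ-≤ (c * k) (n≤1+n 1) ⟩
      c * k + 2          ≤⟨ +-monoˡ-≤ 2 (*-monoʳ-≤ c (≮⇒≥ 2fu≮k)) ⟩
      c * (2 * f u) + 2  ≡⟨ c[2x]+2≡2[cx+1] c (f u) ⟩
      2 * (c * f u + 1)  ∎))
      where open ≤-Reasoning

  liftPositive-strong : ∀ c {k} {f : Fin n → ℕ} {v} → k < 2 * f v →
    (c * k + 1 <ᵇ 2 * liftPositive c f v) ≡ true × liftPositive c f v ≡ c * f v + 1
  liftPositive-strong c {k} {f} {v} k<2fv with f v
  ... | suc x = <⇒<ᵇ≡true (begin-strict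
    c * k + 1            <⟨ +-monoʳ-< (c * k) (n<1+n 1) ⟩
    c * k + 2            ≤⟨ +-monoˡ-≤ 2 (*-monoʳ-≤ c (<⇒≤ k<2fv)) ⟩
    c * (2 * suc x) + 2  ≡⟨ c[2x]+2≡2[cx+1] c (suc x) ⟩
    2 * (c * suc x + 1)  ∎) , refl
    where open ≤-Reasoning

  strongNbrSum-liftPositive : ∀ c {k f} u →
    c * strongNbrSum k f u + count (strongNbr k f u) ≤ strongNbrSum (c * k + 1) (liftPositive c f) u
  strongNbrSum-liftPositive c {k} {f} u = begin
    c * strongNbrSum k f u + count S               ≡⟨ cong (_+ count S) (sumOver-*ˡ S c f) ⟨
    sumOver S (λ v → c * f v) + count S            ≡⟨ sumOver-distrib-+ S (λ v → c * f v) (λ _ → 1) ⟨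
    sumOver S (λ v → c * f v + 1)                  ≤⟨ sumOver-mono S (λ v sv → ≤-reflexive (sym (proj₂ (lift sv)))) ⟩
    sumOver S (liftPositive c f)                   ≤⟨ sumOver-⊆ (liftPositive c f) still-strong ⟩
    strongNbrSum (c * k + 1) (liftPositive c f) u  ∎
    where
    open ≤-Reasoning
    S : Fin n → Bool
    S = strongNbr k f u
    lift : ∀ {v} → S v ≡ true →
           (c * k + 1 <ᵇ 2 * liftPositive c f v) ≡ true × liftPositive c f v ≡ c * f v + 1
    lift {v} sv = liftPositive-strong c {k} {f} {v} (<ᵇ≡true⇒< (∧-conicalʳ (adj G u v) _ sv))
    still-strong : ∀ v → S v ≡ true → strongNbr (c * k + 1) (liftPositive c f) u v ≡ true
    still-strong v sv = cong₂ _∧_ (∧-conicalˡ (adj G u v) _ sv) (proj₁ (lift sv))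

  liftPositive-SRDF : ∀ {c k f} → 1 ≤ k → IsSRDF k G f → IsSRDF (c * k + 1) G (liftPositive c f)
  liftPositive-SRDF {c} {k} {f} k≥1 (f≤k , dom) = g≤ , dom′
    where
    g : Fin n → ℕ
    g = liftPositive c f
    g≤ : ∀ v → g v ≤ c * k + 1
    g≤ v = +-mono-≤ (*-monoʳ-≤ c (f≤k v)) (indicator-≤1 _)
    some-strong : ∀ u → k ≤ strongNbrSum k f u → 1 ≤ count (strongNbr k f u)
    some-strong u k≤ = ≰⇒> λ none → <⇒≱ k≥1 (begin
      k                                  ≤⟨ k≤ ⟩
      strongNbrSum k f u                 ≤⟨ sumOver-≤ (strongNbr k f u) k (λ v _ → f≤k v) ⟩
      k * count (strongNbr k f u)        ≤⟨ *-monoʳ-≤ k none ⟩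
      k * 0                              ≡⟨ *-zeroʳ k ⟩
      0                                  ∎)
      where open ≤-Reasoning
    dom′ : ∀ u → 2 * g u < c * k + 1 → c * k + 1 ≤ g u + strongNbrSum (c * k + 1) g u
    dom′ u small with f u | dom u
    ... | zero  | dom-u = ≤-trans (+-mono-≤ (*-monoʳ-≤ c (dom-u k≥1)) (some-strong u (dom-u k≥1)))
                                  (≤-trans (strongNbrSum-liftPositive c u) (m≤n+m _ _))
    ... | suc x | dom-u with 2 * suc x <? k
    ...   | yes 2fu<k = begin
      c * k + 1                                ≤⟨ +-monoˡ-≤ 1 (*-monoʳ-≤ c (dom-u 2fu<k)) ⟩
      c * (suc x + strongNbrSum k f u) + 1     ≡⟨ c[x+s]+1≡[cx+1]+cs c (suc x) _ ⟩
      (c * suc x + 1) + c * strongNbrSum k f u ≤⟨ +-monoʳ-≤ (c * suc x + 1)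
                                                    (≤-trans (m≤m+n _ _) (strongNbrSum-liftPositive c u)) ⟩
      (c * suc x + 1) + strongNbrSum (c * k + 1) g u ∎
      where open ≤-Reasoning
    ...   | no 2fu≮k = contradiction small (≤⇒≯ (begin
      c * k + 1               ≤⟨ +-monoʳ-≤ (c * k) (n≤1+n 1) ⟩
      c * k + 2               ≤⟨ +-monoˡ-≤ 2 (*-monoʳ-≤ c (≮⇒≥ 2fu≮k)) ⟩
      c * (2 * suc x) + 2     ≡⟨ c[2x]+2≡2[cx+1] c (suc x) ⟩
      2 * (c * suc x + 1)     ∎))
      where open ≤-Reasoning

sumRange-cardV : ∀ {n} (f : Fin n → ℕ) m → sumRange m (cardV f) ≡ count (λ v → f v <ᵇ m)
sumRange-cardV {n} f zero    = sym (trans (sumFin-const n 0) (*-zeroʳ n))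
sumRange-cardV {n} f (suc m) = begin
  sumRange m (cardV f) + cardV f m                  ≡⟨ cong (_+ cardV f m) (sumRange-cardV f m) ⟩
  count (λ v → f v <ᵇ m) + count (λ v → f v ≡ᵇ m)  ≡⟨ sumFin-distrib-+ {n} _ _ ⟨
  sumFin (λ v → indicator (f v <ᵇ m) + indicator (f v ≡ᵇ m))
                                                    ≡⟨ sumFin-cong (λ v → below-suc (f v) m) ⟩
  count (λ v → f v <ᵇ suc m)                       ∎
  where
  open ≡-Reasoning
  indicator : Bool → ℕ
  indicator b = if b then 1 else 0
  below-suc : ∀ x m → indicator (x <ᵇ m) + indicator (x ≡ᵇ m) ≡ indicator (x <ᵇ suc m)
  below-suc zero    zero    = refl
  below-suc zero    (suc m) = refl
  below-suc (suc x) zero    = refl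
  below-suc (suc x) (suc m) = below-suc x m

count-positive+cardV-0 : ∀ {n} (f : Fin n → ℕ) → count (λ v → 0 <ᵇ f v) + cardV f 0 ≡ n
count-positive+cardV-0 {n} f = begin
  count (λ v → 0 <ᵇ f v) + cardV f 0 ≡⟨ sumFin-distrib-+ {n} _ _ ⟨
  sumFin (λ v → (if 0 <ᵇ f v then 1 else 0) + (if f v ≡ᵇ 0 then 1 else 0))
                                     ≡⟨ sumFin-cong (λ v → zero-or-positive (f v)) ⟩
  sumFin {n} (λ _ → 1)               ≡⟨ sumFin-const n 1 ⟩
  n * 1                              ≡⟨ *-identityʳ n ⟩
  n                                  ∎
  where
  open ≡-Reasoning
  zero-or-positive : ∀ x → (if 0 <ᵇ x then 1 else 0) + (if x ≡ᵇ 0 then 1 else 0) ≡ 1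
  zero-or-positive zero    = refl
  zero-or-positive (suc x) = refl

count-positive≤weight : ∀ {n} (f : Fin n → ℕ) → count (λ v → 0 <ᵇ f v) ≤ weight f
count-positive≤weight f = sumFin-mono (λ v → indicator≤ (f v))
  where
  indicator≤ : ∀ x → (if 0 <ᵇ x then 1 else 0) ≤ x
  indicator≤ zero    = z≤n
  indicator≤ (suc x) = s≤s z≤n

weight-liftSmall : ∀ {n} c k (f : Fin n → ℕ) →
                   weight (liftSmall c k f) ≡ c * weight f + sumRange (suc (k / 2)) (cardV f)
weight-liftSmall c k f =
  trans (sumFin-distrib-+ (λ v → c * f v) (λ v → if f v <ᵇ suc (k / 2) then 1 else 0))
        (cong₂ _+_ (sumFin-*ˡ c f) (sym (sumRange-cardV f (suc (k / 2)))))

weight-liftPositive : ∀ {n} c (f : Fin n → ℕ) →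
                      weight (liftPositive c f) ≡ c * weight f + count (λ v → 0 <ᵇ f v)
weight-liftPositive c f =
  trans (sumFin-distrib-+ (λ v → c * f v) (λ v → if 0 <ᵇ f v then 1 else 0))
        (cong (_+ count (λ v → 0 <ᵇ f v)) (sumFin-*ˡ c f))

module _ {n : ℕ} {G : SimpleGraph n} where

  γ-scale : ∀ {c k f g} → IsGammaFun (c * k) G g → IsRDF k G f → weight g ≤ c * weight f
  γ-scale {c} {f = f} (_ , minimal) f-rdf =
    ≤-trans (minimal _ (scale-RDF G c f-rdf)) (≤-reflexive (sumFin-*ˡ c f))

  γˢ-scale : ∀ {c k f g} → IsGammaSFun (c * k) G g → IsSRDF k G f → weight g ≤ c * weight f
  γˢ-scale {c} {f = f} (_ , minimal) f-srdf =
    ≤-trans (minimal _ (scale-SRDF G c f-srdf)) (≤-reflexive (sumFin-*ˡ c f))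

  γ-liftSmall : ∀ {c k f g} → 1 ≤ c → IsGammaFun (c * k + 1) G g → IsRDF k G f →
                weight g ≤ c * weight f + sumRange (suc (k / 2)) (cardV f)
  γ-liftSmall {c} {k} {f} c≥1 (_ , minimal) f-rdf =
    ≤-trans (minimal _ (liftSmall-RDF G {c} {k} c≥1 f-rdf)) (≤-reflexive (weight-liftSmall c k f))

  γˢ-liftPositive : ∀ {c k f g} → 1 ≤ k → IsGammaSFun (c * k + 1) G g → IsSRDF k G f →
                    weight g ≤ c * weight f + count (λ v → 0 <ᵇ f v)
  γˢ-liftPositive {c} {k} {f} k≥1 (_ , minimal) f-srdf =
    ≤-trans (minimal _ (liftPositive-SRDF G {c} k≥1 f-srdf)) (≤-reflexive (weight-liftPositive c f))

  γˢ-liftPositive-cardV : ∀ {c k f g} → 1 ≤ k → IsGammaSFun (c * k + 1) G g → IsSRDF k G f →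
                          weight g + cardV f 0 ≤ c * weight f + n
  γˢ-liftPositive-cardV {c} {k} {f} {g} k≥1 γg f-srdf = begin
    weight g + cardV f 0
      ≤⟨ +-monoˡ-≤ (cardV f 0) (γˢ-liftPositive {c = c} k≥1 γg f-srdf) ⟩
    c * weight f + count (λ v → 0 <ᵇ f v) + cardV f 0  ≡⟨ +-assoc (c * weight f) _ _ ⟩
    c * weight f + (count (λ v → 0 <ᵇ f v) + cardV f 0)
      ≡⟨ cong (c * weight f +_) (count-positive+cardV-0 f) ⟩
    c * weight f + n                                    ∎
    where open ≤-Reasoning

scaled+n≤ : ∀ {n} c (f : Fin n → ℕ) → c * weight f + n ≤ (c + 1) * weight f + cardV f 0
scaled+n≤ {n} c f = begin
  c * weight f + n                                     ≡⟨ cong (c * weight f +_) (count-positive+cardV-0 f) ⟨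
  c * weight f + (count (λ v → 0 <ᵇ f v) + cardV f 0)
    ≤⟨ +-monoʳ-≤ (c * weight f) (+-monoˡ-≤ (cardV f 0) (count-positive≤weight f)) ⟩
  c * weight f + (weight f + cardV f 0)                ≡⟨ cw+[w+z]≡[c+1]w+z c (weight f) (cardV f 0) ⟩
  (c + 1) * weight f + cardV f 0                       ∎
  where
  open ≤-Reasoning
  cw+[w+z]≡[c+1]w+z : ∀ c w z → c * w + (w + z) ≡ (c + 1) * w + z
  cw+[w+z]≡[c+1]w+z = solve-∀

sumRange-cardV≤n : ∀ {n} (f : Fin n → ℕ) m → sumRange m (cardV f) ≤ n
sumRange-cardV≤n f m = ≤-trans (≤-reflexive (sumRange-cardV f m)) (count-≤ (λ v → f v <ᵇ m))

-- From k = 2 to arbitrary k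

odd-half : ∀ k → ¬ 2 ∣ k → ∃ λ c → k ≡ c * 2 + 1
odd-half k k-odd with k % 2 | m≡m%n+[m/n]*n k 2 | m%n<n k 2
... | 0           | k≡ | _ = contradiction (divides (k / 2) k≡) k-odd
... | 1           | k≡ | _ = k / 2 , trans k≡ (+-comm 1 _)
... | suc (suc _) | _  | s≤s (s≤s ())

module _ {n : ℕ} {G : SimpleGraph n} (h : Fin n → ℕ) where

  γ-even-bound : ∀ {c f} → IsRDF 2 G h → 4 * weight h ≤ 3 * n →
                 IsGammaFun (c * 2) G f → 8 * weight f ≤ 3 * (c * 2) * n
  γ-even-bound {c} {f} h-rdf h-light γf = begin
    8 * weight f        ≤⟨ *-monoʳ-≤ 8 (γ-scale {G = G} {c = c} γf h-rdf) ⟩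
    8 * (c * weight h)  ≡⟨ 8[cw]≡2c[4w] c (weight h) ⟩
    2 * c * (4 * weight h) ≤⟨ *-monoʳ-≤ (2 * c) h-light ⟩
    2 * c * (3 * n)     ≡⟨ 2c[3n]≡3[2c]n c n ⟩
    3 * (c * 2) * n     ∎
    where
    open ≤-Reasoning
    8[cw]≡2c[4w] : ∀ c w → 8 * (c * w) ≡ 2 * c * (4 * w)
    8[cw]≡2c[4w] = solve-∀
    2c[3n]≡3[2c]n : ∀ c n → 2 * c * (3 * n) ≡ 3 * (c * 2) * n
    2c[3n]≡3[2c]n = solve-∀

  γˢ-even-bound : ∀ {c f} → IsSRDF 2 G h → 5 * weight h ≤ 4 * n →
                  IsGammaSFun (c * 2) G f → 5 * weight f ≤ 2 * (c * 2) * n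
  γˢ-even-bound {c} {f} h-srdf h-light γf = begin
    5 * weight f        ≤⟨ *-monoʳ-≤ 5 (γˢ-scale {G = G} {c = c} γf h-srdf) ⟩
    5 * (c * weight h)  ≡⟨ 5[cw]≡c[5w] c (weight h) ⟩
    c * (5 * weight h)  ≤⟨ *-monoʳ-≤ c h-light ⟩
    c * (4 * n)         ≡⟨ c[4n]≡2[2c]n c n ⟩
    2 * (c * 2) * n     ∎
    where
    open ≤-Reasoning
    5[cw]≡c[5w] : ∀ c w → 5 * (c * w) ≡ c * (5 * w)
    5[cw]≡c[5w] = solve-∀
    c[4n]≡2[2c]n : ∀ c n → c * (4 * n) ≡ 2 * (c * 2) * n
    c[4n]≡2[2c]n = solve-∀

  γ-odd-bound : ∀ {c f} → 1 ≤ c → IsRDF 2 G h → 4 * weight h ≤ 3 * n →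
                IsGammaFun (c * 2 + 1) G f → 8 * weight f ≤ (3 * (c * 2 + 1) + 5) * n
  γ-odd-bound {c} {f} c≥1 h-rdf h-light γf = begin
    8 * weight f                          ≤⟨ *-monoʳ-≤ 8 (γ-liftSmall {G = G} {c = c} c≥1 γf h-rdf) ⟩
    8 * (c * weight h + sumRange 2 (cardV h))
                                          ≤⟨ *-monoʳ-≤ 8 (+-monoʳ-≤ (c * weight h) (sumRange-cardV≤n h 2)) ⟩
    8 * (c * weight h + n)                ≡⟨ 8[cw+n]≡2c[4w]+8n c (weight h) n ⟩
    2 * c * (4 * weight h) + 8 * n        ≤⟨ +-monoˡ-≤ (8 * n) (*-monoʳ-≤ (2 * c) h-light) ⟩
    2 * c * (3 * n) + 8 * n               ≡⟨ 2c[3n]+8n≡[3[2c+1]+5]n c n ⟩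
    (3 * (c * 2 + 1) + 5) * n             ∎
    where
    open ≤-Reasoning
    8[cw+n]≡2c[4w]+8n : ∀ c w n → 8 * (c * w + n) ≡ 2 * c * (4 * w) + 8 * n
    8[cw+n]≡2c[4w]+8n = solve-∀
    2c[3n]+8n≡[3[2c+1]+5]n : ∀ c n → 2 * c * (3 * n) + 8 * n ≡ (3 * (c * 2 + 1) + 5) * n
    2c[3n]+8n≡[3[2c+1]+5]n = solve-∀

  γˢ-odd-bound : ∀ {c f} → IsSRDF 2 G h → 5 * weight h ≤ 4 * n →
                 IsGammaSFun (c * 2 + 1) G f → 5 * weight f ≤ 2 * (c * 2 + 1 + 1) * n
  γˢ-odd-bound {c} {f} h-srdf h-light γf = begin
    5 * weight f
                                       ≤⟨ *-monoʳ-≤ 5 (γˢ-liftPositive {G = G} {c = c} (s≤s z≤n) γf h-srdf) ⟩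
    5 * (c * weight h + count (λ v → 0 <ᵇ h v))
                                       ≤⟨ *-monoʳ-≤ 5 (+-monoʳ-≤ (c * weight h) (count-positive≤weight h)) ⟩
    5 * (c * weight h + weight h)      ≡⟨ 5[cw+w]≡[c+1][5w] c (weight h) ⟩
    (c + 1) * (5 * weight h)           ≤⟨ *-monoʳ-≤ (c + 1) h-light ⟩
    (c + 1) * (4 * n)                  ≡⟨ [c+1][4n]≡2[2c+2]n c n ⟩
    2 * (c * 2 + 1 + 1) * n            ∎
    where
    open ≤-Reasoning
    5[cw+w]≡[c+1][5w] : ∀ c w → 5 * (c * w + w) ≡ (c + 1) * (5 * w)
    5[cw+w]≡[c+1][5w] = solve-∀
    [c+1][4n]≡2[2c+2]n : ∀ c n → (c + 1) * (4 * n) ≡ 2 * (c * 2 + 1 + 1) * n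
    [c+1][4n]≡2[2c+2]n = solve-∀

-- Leaves, stems and the two 2-functions

Subgraph : ∀ {n} → SimpleGraph n → SimpleGraph n → Set
Subgraph E G = ∀ u v → adj E u v ≡ true → adj G u v ≡ true

module Degrees {n : ℕ} (E : SimpleGraph n) where

  deg : Fin n → ℕ
  deg u = count (adj E u)

  leaf : Fin n → Bool
  leaf u = deg u ≡ᵇ 1

  leafNbr : Fin n → Fin n → Bool
  leafNbr u v = adj E u v ∧ leaf v

  innerNbr : Fin n → Fin n → Bool
  innerNbr u v = adj E u v ∧ not (leaf v)

  leafDeg : Fin n → ℕ
  leafDeg u = count (leafNbr u)

  innerDeg : Fin n → ℕ
  innerDeg u = count (innerNbr u)

  stem : Fin n → Bool
  stem u = (leafDeg u ≡ᵇ 1) ∧ (innerDeg u ≡ᵇ 1)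

  NoIsolated : Set
  NoIsolated = ∀ u → 0 < deg u

  NoLeafEdge : Set
  NoLeafEdge = ∀ u v → adj E u v ≡ true → leaf u ≡ true → leaf v ≡ false

  StemCovered : Set
  StemCovered = ∀ u v → adj E u v ≡ true → leaf u ≡ false → leaf v ≡ false →
                stem u ≡ true ⊎ stem v ≡ true

  adj-sym : ∀ {u v} → adj E u v ≡ true → adj E v u ≡ true
  adj-sym {u} {v} e = trans (SimpleGraph.sym E v u) e

  adj⇒≢ : ∀ {u v} → adj E u v ≡ true → u ≢ v
  adj⇒≢ {u} e refl = both-true-false e (SimpleGraph.irrefl E u)

  leafNbr⇒leaf : ∀ {u v} → leafNbr u v ≡ true → leaf v ≡ true
  leafNbr⇒leaf {u} {v} = ∧-conicalʳ (adj E u v) (leaf v)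

  innerNbr⇒nonleaf : ∀ {u v} → innerNbr u v ≡ true → leaf v ≡ false
  innerNbr⇒nonleaf {u} {v} e = not-injective (∧-conicalʳ (adj E u v) (not (leaf v)) e)

  deg≡leafDeg+innerDeg : ∀ u → deg u ≡ leafDeg u + innerDeg u
  deg≡leafDeg+innerDeg u = sumOver-split (adj E u) leaf (λ _ → 1)

  leaf⇒deg≡1 : ∀ {u} → leaf u ≡ true → deg u ≡ 1
  leaf⇒deg≡1 = ≡ᵇ≡true⇒≡

  nonleaf⇒deg≥2 : NoIsolated → ∀ {u} → leaf u ≡ false → 2 ≤ deg u
  nonleaf⇒deg≥2 noIso {u} nonleaf with deg u | noIso u
  ... | suc zero    | _ = contradiction nonleaf λ ()
  ... | suc (suc _) | _ = s≤s (s≤s z≤n)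

  leaf-nbr-unique : ∀ {y u z} → leaf y ≡ true → adj E y u ≡ true → adj E y z ≡ true → z ≡ u
  leaf-nbr-unique {y} ly ayu ayz = count-unique (adj E y) (leaf⇒deg≡1 ly) ayz ayu

  stem-leafDeg : ∀ {u} → stem u ≡ true → leafDeg u ≡ 1
  stem-leafDeg s = ≡ᵇ≡true⇒≡ (∧-conicalˡ _ _ s)

  stem-innerDeg : ∀ {u} → stem u ≡ true → innerDeg u ≡ 1
  stem-innerDeg s = ≡ᵇ≡true⇒≡ (∧-conicalʳ _ _ s)

  stem⇒nonleaf : ∀ {u} → stem u ≡ true → leaf u ≡ false
  stem⇒nonleaf {u} s with deg u in d
  ... | zero        = refl
  ... | suc zero    = contradiction (trans (sym d) (trans (deg≡leafDeg+innerDeg u)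
                        (cong₂ _+_ (stem-leafDeg s) (stem-innerDeg s)))) λ ()
  ... | suc (suc _) = refl

  stem-intro : ∀ {u} → leafDeg u ≡ 1 → innerDeg u ≡ 1 → stem u ≡ true
  stem-intro l i = cong₂ _∧_ (≡⇒≡ᵇ≡true l) (≡⇒≡ᵇ≡true i)

  deg2-stem : ∀ {u y w} → deg u ≡ 2 → adj E u y ≡ true → leaf y ≡ true →
              adj E u w ≡ true → leaf w ≡ false → stem u ≡ true
  deg2-stem {u} {y} {w} d auy ly auw lw = stem-intro (proj₁ split) (proj₂ split)
    where
    split : leafDeg u ≡ 1 × innerDeg u ≡ 1
    split = both-one (count-≥1 (leafNbr u) (cong₂ _∧_ auy ly))
                     (count-≥1 (innerNbr u) (cong₂ _∧_ auw (cong not lw)))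
                     (trans (sym (deg≡leafDeg+innerDeg u)) d)
      where
      both-one : ∀ {x y} → 1 ≤ x → 1 ≤ y → x + y ≡ 2 → x ≡ 1 × y ≡ 1
      both-one {1} {1} _ _ _ = refl , refl
      both-one {1} {suc (suc _)} _ _ ()
      both-one {suc (suc a)} {suc _} _ _ e = contradiction (suc-injective (suc-injective e)) (m+1+n≢0 a)

  nbr-with : ∀ (q : Fin n → Bool) {u} → 0 < count (λ v → adj E u v ∧ q v) →
             ∃ λ v → adj E u v ≡ true × q v ≡ true
  nbr-with q {u} pos with count-witness (λ v → adj E u v ∧ q v) pos
  ... | v , e = v , ∧-conicalˡ _ _ e , ∧-conicalʳ _ _ e

  stem-leaf-nbr : ∀ {u} → stem u ≡ true → ∃ λ y → adj E u y ≡ true × leaf y ≡ true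
  stem-leaf-nbr s = nbr-with leaf (≤-reflexive (sym (stem-leafDeg s)))

  stem-inner-nbr : ∀ {u} → stem u ≡ true → ∃ λ w → adj E u w ≡ true × leaf w ≡ false
  stem-inner-nbr s with nbr-with (not ∘ leaf) (≤-reflexive (sym (stem-innerDeg s)))
  ... | w , auw , nlw = w , auw , not-injective nlw

  stem-inner-unique : ∀ {u w w′} → stem u ≡ true → adj E u w ≡ true → leaf w ≡ false →
                      adj E u w′ ≡ true → leaf w′ ≡ false → w ≡ w′
  stem-inner-unique {u} s auw lw auw′ lw′ =
    count-unique (innerNbr u) (stem-innerDeg s) (cong₂ _∧_ auw (cong not lw))
                 (cong₂ _∧_ auw′ (cong not lw′))

  hasNbr : (Fin n → Bool) → Fin n → Bool
  hasNbr q u = 0 <ᵇ count (λ v → adj E u v ∧ q v)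

  hasNbr-witness : ∀ q {u} → hasNbr q u ≡ true → ∃ λ v → adj E u v ≡ true × q v ≡ true
  hasNbr-witness q h = nbr-with q (<ᵇ≡true⇒< h)

  hasNbr-intro : ∀ q {u v} → adj E u v ≡ true → q v ≡ true → hasNbr q u ≡ true
  hasNbr-intro q {u} auv qv = <⇒<ᵇ≡true (count-≥1 (λ w → adj E u w ∧ q w) (cong₂ _∧_ auv qv))

  hasNbr-false : ∀ q {u v} → hasNbr q u ≡ false → adj E u v ≡ true → q v ≡ false
  hasNbr-false q {u} {v} none auv with true-or-false (q v)
  ... | inj₁ qv = ⊥-elim (both-true-false (hasNbr-intro q auv qv) none)
  ... | inj₂ qv = qv

  hasNbr-none : ∀ q {u} → (∀ v → adj E u v ≡ true → q v ≡ false) → hasNbr q u ≡ false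
  hasNbr-none q {u} none with true-or-false (hasNbr q u)
  ... | inj₂ h = h
  ... | inj₁ h with hasNbr-witness q h
  ...   | v , auv , qv = ⊥-elim (both-true-false qv (none v auv))

  discharging : ∀ (f : Fin n → ℕ) (charge : Fin n → Fin n → ℕ) a b →
    (∀ u → a * f u + sumOver (adj E u) (charge u) ≤ b + sumOver (adj E u) (λ v → charge v u)) →
    a * weight f ≤ b * n
  discharging f charge a b balance = +-cancelʳ-≤ total (a * weight f) (b * n) (begin
    a * weight f + total                ≡⟨ cong (_+ total) (sumFin-*ˡ a f) ⟨
    sumFin (λ u → a * f u) + total      ≡⟨ sumFin-distrib-+ (λ u → a * f u) sent ⟨
    sumFin (λ u → a * f u + sent u)     ≤⟨ sumFin-mono balance ⟩
    sumFin (λ u → b + received u)       ≡⟨ sumFin-distrib-+ (λ _ → b) received ⟩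
    sumFin {n} (λ _ → b) + sumFin received
                                        ≡⟨ cong₂ _+_ (trans (sumFin-const n b) (*-comm n b)) received≡sent ⟩
    b * n + total                       ∎)
    where
    open ≤-Reasoning
    sent received : Fin n → ℕ
    sent u = sumOver (adj E u) (charge u)
    received u = sumOver (adj E u) (λ v → charge v u)
    total : ℕ
    total = sumFin sent
    received≡sent : sumFin received ≡ total
    received≡sent = trans (sumFin-cong (λ u → sumFin-cong (λ v →
                            cong (λ b → if b then charge v u else 0) (SimpleGraph.sym E u v))))
                          (sumFin-comm (λ u v → if adj E v u then charge v u else 0))

  sumOver-adj-≤ : ∀ u (g : Fin n → ℕ) cₗ cᵢ →
    (∀ v → leafNbr u v ≡ true → g v ≤ cₗ) → (∀ v → innerNbr u v ≡ true → g v ≤ cᵢ) →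
    sumOver (adj E u) g ≤ cₗ * leafDeg u + cᵢ * innerDeg u
  sumOver-adj-≤ u g cₗ cᵢ onLeaves onInner = begin
    sumOver (adj E u) g                                ≡⟨ sumOver-split (adj E u) leaf g ⟩
    sumOver (leafNbr u) g + sumOver (innerNbr u) g     ≤⟨ +-mono-≤ (sumOver-≤ (leafNbr u) cₗ onLeaves)
                                                                   (sumOver-≤ (innerNbr u) cᵢ onInner) ⟩
    cₗ * leafDeg u + cᵢ * innerDeg u                   ∎
    where open ≤-Reasoning

  sumOver-adj-≥ : ∀ u (g : Fin n → ℕ) cₗ cᵢ →
    (∀ v → leafNbr u v ≡ true → cₗ ≤ g v) → (∀ v → innerNbr u v ≡ true → cᵢ ≤ g v) →
    cₗ * leafDeg u + cᵢ * innerDeg u ≤ sumOver (adj E u) g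
  sumOver-adj-≥ u g cₗ cᵢ onLeaves onInner = begin
    cₗ * leafDeg u + cᵢ * innerDeg u                   ≤⟨ +-mono-≤ (sumOver-≥ (leafNbr u) cₗ onLeaves)
                                                                   (sumOver-≥ (innerNbr u) cᵢ onInner) ⟩
    sumOver (leafNbr u) g + sumOver (innerNbr u) g     ≡⟨ sumOver-split (adj E u) leaf g ⟨
    sumOver (adj E u) g                                ∎
    where open ≤-Reasoning

module StemStructure {n : ℕ} (E : SimpleGraph n) where

  open Degrees E

  leadStem : Fin n → Bool
  leadStem u = stem u ∧ hasNbr (λ w → stem w ∧ (toℕ u <ᵇ toℕ w)) u

  leadStem⇒stem : ∀ {u} → leadStem u ≡ true → stem u ≡ true
  leadStem⇒stem {u} = ∧-conicalˡ (stem u) _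

  leadStem-partner : ∀ {u w} → leadStem u ≡ true → adj E u w ≡ true → leaf w ≡ false →
                     stem w ≡ true × toℕ u < toℕ w
  leadStem-partner {u} {w} lead auw lw with hasNbr-witness _ (∧-conicalʳ (stem u) _ lead)
  ... | z , auz , later = subst (λ x → stem x ≡ true × toℕ u < toℕ x) z≡w
                                (sz , <ᵇ≡true⇒< (∧-conicalʳ (stem z) _ later))
    where
    sz : stem z ≡ true
    sz = ∧-conicalˡ (stem z) _ later
    z≡w : z ≡ w
    z≡w = stem-inner-unique (leadStem⇒stem lead) auz (stem⇒nonleaf sz) auw lw

  leadStem-intro : ∀ {u w} → stem u ≡ true → adj E u w ≡ true → stem w ≡ true → toℕ u < toℕ w →
                   leadStem u ≡ true
  leadStem-intro su auw sw u<w = cong₂ _∧_ su (hasNbr-intro _ auw (cong₂ _∧_ sw (<⇒<ᵇ≡true u<w)))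

  nonlead-stems-nonadjacent : ∀ {u w} → stem u ≡ true × leadStem u ≡ false →
                              stem w ≡ true × leadStem w ≡ false → adj E u w ≡ true → ⊥
  nonlead-stems-nonadjacent {u} {w} (su , ¬lu) (sw , ¬lw) auw with <-cmp (toℕ u) (toℕ w)
  ... | tri< u<w _ _ = both-true-false (leadStem-intro su auw sw u<w) ¬lu
  ... | tri≈ _ u≡w _ = adj⇒≢ auw (toℕ-injective u≡w)
  ... | tri> _ _ w<u = both-true-false (leadStem-intro sw (adj-sym auw) su w<u) ¬lw

  leadStems-nonadjacent : ∀ {u w} → leadStem u ≡ true → leadStem w ≡ true → adj E u w ≡ true → ⊥
  leadStems-nonadjacent lu lw auw =
    <-asym (proj₂ (leadStem-partner lu auw (stem⇒nonleaf (leadStem⇒stem lw))))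
           (proj₂ (leadStem-partner lw (adj-sym auw) (stem⇒nonleaf (leadStem⇒stem lu))))

  module Heavy (covered : StemCovered) (H : Fin n → Bool)
               (H⇒nonleaf : ∀ {u} → H u ≡ true → leaf u ≡ false)
               (H-stem⇒lead : ∀ {u} → H u ≡ true → stem u ≡ true → leadStem u ≡ true) where

    heavy-inner-nbr-stem : ∀ {u v} → H u ≡ true → adj E u v ≡ true → leaf v ≡ false → stem v ≡ true
    heavy-inner-nbr-stem {u} {v} hu auv lv with covered u v auv (H⇒nonleaf hu) lv
    ... | inj₁ su = proj₁ (leadStem-partner (H-stem⇒lead hu su) auv lv)
    ... | inj₂ sv = sv

    heavy-nonadjacent : ∀ {u v} → H u ≡ true → H v ≡ true → adj E u v ≡ true → ⊥
    heavy-nonadjacent hu hv auv =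
      leadStems-nonadjacent (H-stem⇒lead hu (heavy-inner-nbr-stem hv (adj-sym auv) (H⇒nonleaf hu)))
                            (H-stem⇒lead hv (heavy-inner-nbr-stem hu auv (H⇒nonleaf hv))) auv

module Roman {n : ℕ} (E : SimpleGraph n) where

  open Degrees E
  open StemStructure E

  heavy : Fin n → Bool
  heavy u = not (leaf u) ∧ (not (stem u) ∨ leadStem u)

  romanFun : Fin n → ℕ
  romanFun u = if heavy u then 2 else if leaf u ∧ not (hasNbr heavy u) then 1 else 0

  heavy⇒nonleaf : ∀ {u} → heavy u ≡ true → leaf u ≡ false
  heavy⇒nonleaf {u} h with leaf u
  ... | false = refl

  heavy-stem⇒lead : ∀ {u} → heavy u ≡ true → stem u ≡ true → leadStem u ≡ true
  heavy-stem⇒lead {u} h s with leaf u | stem u | leadStem u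
  heavy-stem⇒lead h s | false | true | true = refl

  unheavy-nonleaf⇒stem : ∀ {u} → heavy u ≡ false → leaf u ≡ false → stem u ≡ true × leadStem u ≡ false
  unheavy-nonleaf⇒stem {u} h l with leaf u | stem u | leadStem u
  unheavy-nonleaf⇒stem h l | false | true | false = refl , refl

  romanFun-heavy : ∀ {u} → heavy u ≡ true → romanFun u ≡ 2
  romanFun-heavy h rewrite h = refl

  romanFun-leaf-alone : ∀ {u} → leaf u ≡ true → hasNbr heavy u ≡ false → romanFun u ≡ 1
  romanFun-leaf-alone {u} l none rewrite l | none = refl

  romanFun-leaf-covered : ∀ {u} → leaf u ≡ true → hasNbr heavy u ≡ true → romanFun u ≡ 0
  romanFun-leaf-covered {u} l some rewrite l | some = refl

  romanFun-unheavy-nonleaf : ∀ {u} → heavy u ≡ false → leaf u ≡ false → romanFun u ≡ 0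
  romanFun-unheavy-nonleaf {u} h l rewrite h | l = refl

  romanFun≤2 : ∀ u → romanFun u ≤ 2
  romanFun≤2 u with heavy u | leaf u ∧ not (hasNbr heavy u)
  ... | true  | _     = ≤-refl
  ... | false | true  = s≤s z≤n
  ... | false | false = z≤n

  module _ (covered : StemCovered) where

    romanFun≡0⇒heavy-nbr : ∀ {u} → romanFun u ≡ 0 → ∃ λ w → adj E u w ≡ true × heavy w ≡ true
    romanFun≡0⇒heavy-nbr {u} zero-at-u with true-or-false (heavy u) | true-or-false (leaf u)
    ... | inj₁ hu | _ = contradiction (trans (sym (romanFun-heavy hu)) zero-at-u) λ ()
    ... | inj₂ hu | inj₁ lu with true-or-false (hasNbr heavy u)
    ...   | inj₁ some = hasNbr-witness heavy some
    ...   | inj₂ none = contradiction (trans (sym (romanFun-leaf-alone lu none)) zero-at-u) λ ()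
    romanFun≡0⇒heavy-nbr {u} zero-at-u | inj₂ hu | inj₂ lu
      with stem-inner-nbr (proj₁ (unheavy-nonleaf⇒stem hu lu))
    ... | w , auw , lw with true-or-false (heavy w)
    ...   | inj₁ hw = w , auw , hw
    ...   | inj₂ hw =
      ⊥-elim (nonlead-stems-nonadjacent (unheavy-nonleaf⇒stem hu lu) (unheavy-nonleaf⇒stem hw lw) auw)

    romanFun-SRDF : ∀ (G : SimpleGraph n) → Subgraph E G → IsSRDF 2 G romanFun
    romanFun-SRDF G E⊆G = romanFun≤2 , dom
      where
      dom : ∀ u → 2 * romanFun u < 2 → 2 ≤ romanFun u + strongNbrSum G 2 romanFun u
      dom u small with romanFun≡0⇒heavy-nbr (2*x<2⇒x≡0 small)
      ... | w , auw , hw = begin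
        2                                        ≡⟨ romanFun-heavy hw ⟨
        romanFun w                               ≤⟨ sumOver-≥-term (strongNbr G 2 romanFun u) romanFun strong-w ⟩
        strongNbrSum G 2 romanFun u              ≤⟨ m≤n+m _ (romanFun u) ⟩
        romanFun u + strongNbrSum G 2 romanFun u ∎
        where
        open ≤-Reasoning
        strong-w : strongNbr G 2 romanFun u w ≡ true
        strong-w = cong₂ _∧_ (E⊆G u w auw) (cong (λ x → 2 <ᵇ 2 * x) (romanFun-heavy hw))

  charge : Fin n → Fin n → ℕ
  charge u v = if leaf u then (if heavy v then 4 else 0)
               else if heavy u then 0
               else if leaf v then 1 else 3

  charge-leaf-≤4 : ∀ {u} v → leaf u ≡ true → charge u v ≤ 4
  charge-leaf-≤4 {u} v l rewrite l with heavy v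
  ... | true  = ≤-refl
  ... | false = z≤n

  charge-leaf-unheavy : ∀ {u v} → leaf u ≡ true → heavy v ≡ false → charge u v ≡ 0
  charge-leaf-unheavy l h rewrite l | h = refl

  charge-leaf-heavy : ∀ {u v} → leaf u ≡ true → heavy v ≡ true → charge u v ≡ 4
  charge-leaf-heavy l h rewrite l | h = refl

  charge-heavy : ∀ {u} v → heavy u ≡ true → charge u v ≡ 0
  charge-heavy {u} v h rewrite h | heavy⇒nonleaf h = refl

  charge-unheavy-leaf : ∀ {u v} → leaf u ≡ false → heavy u ≡ false → leaf v ≡ true → charge u v ≡ 1
  charge-unheavy-leaf lu hu lv rewrite lu | hu | lv = refl

  charge-unheavy-inner : ∀ {u v} → leaf u ≡ false → heavy u ≡ false → leaf v ≡ false → charge u v ≡ 3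
  charge-unheavy-inner lu hu lv rewrite lu | hu | lv = refl

  module _ (noIso : NoIsolated) (noLeafEdge : NoLeafEdge) (covered : StemCovered) where

    sent received : Fin n → ℕ
    sent u = sumOver (adj E u) (charge u)
    received u = sumOver (adj E u) (λ v → charge v u)

    open Heavy covered heavy heavy⇒nonleaf heavy-stem⇒lead

    balance-leaf-covered : ∀ {u} → leaf u ≡ true → hasNbr heavy u ≡ true →
                           5 * romanFun u + sent u ≤ 4 + received u
    balance-leaf-covered {u} lu some rewrite romanFun-leaf-covered lu some = begin
      sent u         ≤⟨ sumOver-≤ (adj E u) 4 (λ v _ → charge-leaf-≤4 v lu) ⟩
      4 * deg u      ≡⟨ cong (4 *_) (leaf⇒deg≡1 lu) ⟩
      4              ≤⟨ m≤m+n 4 _ ⟩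
      4 + received u ∎
      where open ≤-Reasoning

    balance-leaf-alone : ∀ {u} → leaf u ≡ true → hasNbr heavy u ≡ false →
                         5 * romanFun u + sent u ≤ 4 + received u
    balance-leaf-alone {u} lu none with count-witness (adj E u) (noIso u)
    ... | x , aux rewrite romanFun-leaf-alone lu none = begin
      5 + sent u      ≤⟨ +-monoʳ-≤ 5 sends-nothing ⟩
      5 + 0           ≡⟨ cong (4 +_) (sym gift) ⟩
      4 + charge x u  ≤⟨ +-monoʳ-≤ 4 (sumOver-≥-term (adj E u) (λ v → charge v u) aux) ⟩
      4 + received u  ∎
      where
      open ≤-Reasoning
      sends-nothing : sent u ≤ 0
      sends-nothing = sumOver-≤ (adj E u) 0 λ v auv →
                        ≤-reflexive (charge-leaf-unheavy lu (hasNbr-false heavy none auv))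
      gift : charge x u ≡ 1
      gift = charge-unheavy-leaf (noLeafEdge u x aux lu) (hasNbr-false heavy none aux) lu

    balance-heavy : ∀ {u} → heavy u ≡ true → 5 * romanFun u + sent u ≤ 4 + received u
    balance-heavy {u} hu rewrite romanFun-heavy hu = begin
      10 + sent u     ≤⟨ +-monoʳ-≤ 10 (sumOver-≤ (adj E u) 0 λ v _ → ≤-reflexive (charge-heavy v hu)) ⟩
      4 + 3 * 2       ≤⟨ +-monoʳ-≤ 4 (*-monoʳ-≤ 3 (nonleaf⇒deg≥2 noIso (heavy⇒nonleaf hu))) ⟩
      4 + 3 * deg u   ≤⟨ +-monoʳ-≤ 4 (sumOver-≥ (adj E u) 3 gift) ⟩
      4 + received u  ∎
      where
      open ≤-Reasoning
      gift : ∀ v → adj E u v ≡ true → 3 ≤ charge v u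
      gift v auv with true-or-false (leaf v)
      ... | inj₁ lv = ≤-trans (n≤1+n 3) (≤-reflexive (sym (charge-leaf-heavy lv hu)))
      ... | inj₂ lv = ≤-reflexive (sym (charge-unheavy-inner lv unheavy (heavy⇒nonleaf hu)))
        where
        unheavy : heavy v ≡ false
        unheavy with true-or-false (heavy v)
        ... | inj₁ hv = ⊥-elim (heavy-nonadjacent hu hv auv)
        ... | inj₂ hv = hv

    balance-stem : ∀ {u} → leaf u ≡ false → heavy u ≡ false → 5 * romanFun u + sent u ≤ 4 + received u
    balance-stem {u} lu hu rewrite romanFun-unheavy-nonleaf hu lu = begin
      sent u                            ≤⟨ sumOver-adj-≤ u (charge u) 1 3 to-leaf to-inner ⟩
      1 * leafDeg u + 3 * innerDeg u    ≡⟨ cong₂ (λ l i → 1 * l + 3 * i) (stem-leafDeg su) (stem-innerDeg su) ⟩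
      4                                 ≤⟨ m≤m+n 4 _ ⟩
      4 + received u                    ∎
      where
      open ≤-Reasoning
      to-leaf : ∀ v → leafNbr u v ≡ true → charge u v ≤ 1
      to-leaf v e = ≤-reflexive (charge-unheavy-leaf lu hu (leafNbr⇒leaf e))
      to-inner : ∀ v → innerNbr u v ≡ true → charge u v ≤ 3
      to-inner v e = ≤-reflexive (charge-unheavy-inner lu hu (innerNbr⇒nonleaf e))
      su : stem u ≡ true
      su = proj₁ (unheavy-nonleaf⇒stem hu lu)

    balance : ∀ u → 5 * romanFun u + sent u ≤ 4 + received u
    balance u with true-or-false (leaf u) | true-or-false (heavy u)
    ... | inj₁ lu | _ with true-or-false (hasNbr heavy u)
    ...   | inj₁ some = balance-leaf-covered lu some
    ...   | inj₂ none = balance-leaf-alone lu none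
    balance u | inj₂ lu | inj₁ hu = balance-heavy hu
    balance u | inj₂ lu | inj₂ hu = balance-stem lu hu

    romanFun-weight : 5 * weight romanFun ≤ 4 * n
    romanFun-weight = discharging romanFun charge 5 4 balance

module Italian {n : ℕ} (E : SimpleGraph n) where

  open Degrees E
  open StemStructure E

  heavy : Fin n → Bool
  heavy u = not (leaf u) ∧ ((not (stem u) ∧ (0 <ᵇ leafDeg u)) ∨ leadStem u)

  light : Fin n → Bool
  light u = not (leaf u) ∧ (not (stem u) ∧ (leafDeg u ≡ᵇ 0))

  italianFun : Fin n → ℕ
  italianFun u = if heavy u then 2 else if light u ∨ (leaf u ∧ not (hasNbr heavy u)) then 1 else 0

  heavy⇒nonleaf : ∀ {u} → heavy u ≡ true → leaf u ≡ false
  heavy⇒nonleaf {u} h with leaf u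
  ... | false = refl

  heavy-stem⇒lead : ∀ {u} → heavy u ≡ true → stem u ≡ true → leadStem u ≡ true
  heavy-stem⇒lead {u} h s with leaf u | stem u | leadStem u
  heavy-stem⇒lead h s | false | true | true = refl

  heavy-cases : ∀ {u} → heavy u ≡ true → (stem u ≡ false × 0 < leafDeg u) ⊎ leadStem u ≡ true
  heavy-cases {u} h with leaf u | stem u | 0 <ᵇ leafDeg u in pos | leadStem u
  ... | false | false | true | _    = inj₁ (refl , <ᵇ≡true⇒< pos)
  ... | false | _     | _    | true = inj₂ refl

  light-parts : ∀ {u} → light u ≡ true → stem u ≡ false × leafDeg u ≡ 0
  light-parts {u} l with leaf u | stem u | leafDeg u ≡ᵇ 0 in none
  ... | false | false | true = refl , ≡ᵇ≡true⇒≡ none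

  stem⇒unlight : ∀ {u} → stem u ≡ true → light u ≡ false
  stem⇒unlight {u} s rewrite s = ∧-zeroʳ (not (leaf u))

  light⇒nonleaf : ∀ {u} → light u ≡ true → leaf u ≡ false
  light⇒nonleaf {u} l with leaf u
  ... | false = refl

  light⇒unheavy : ∀ {u} → light u ≡ true → heavy u ≡ false
  light⇒unheavy {u} l with light-parts l
  ... | unstem , none rewrite unstem | none with leaf u
  ...   | true  = refl
  ...   | false = refl

  neither⇒stem : ∀ {u} → leaf u ≡ false → heavy u ≡ false → light u ≡ false →
                 stem u ≡ true × leadStem u ≡ false
  neither⇒stem {u} l h i = by-cases (leaf u) (stem u) (leafDeg u) (leadStem u) l h i
    where
    by-cases : ∀ l s d lead → l ≡ false → (not l ∧ ((not s ∧ (0 <ᵇ d)) ∨ lead)) ≡ false →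
               (not l ∧ (not s ∧ (d ≡ᵇ 0))) ≡ false → s ≡ true × lead ≡ false
    by-cases false true  _       false _ _  _  = refl , refl
    by-cases false true  _       true  _ () _
    by-cases false false zero    _     _ _  ()
    by-cases false false (suc _) _     _ () _

  italianFun-heavy : ∀ {u} → heavy u ≡ true → italianFun u ≡ 2
  italianFun-heavy h rewrite h = refl

  italianFun-light : ∀ {u} → light u ≡ true → italianFun u ≡ 1
  italianFun-light l rewrite light⇒unheavy l | l = refl

  italianFun-leaf-alone : ∀ {u} → leaf u ≡ true → hasNbr heavy u ≡ false → italianFun u ≡ 1
  italianFun-leaf-alone l none rewrite l | none = refl

  italianFun-leaf-covered : ∀ {u} → leaf u ≡ true → hasNbr heavy u ≡ true → italianFun u ≡ 0
  italianFun-leaf-covered l some rewrite l | some = refl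

  italianFun-neither : ∀ {u} → leaf u ≡ false → heavy u ≡ false → light u ≡ false → italianFun u ≡ 0
  italianFun-neither l h i rewrite h | i | l = refl

  italianFun≤2 : ∀ u → italianFun u ≤ 2
  italianFun≤2 u with heavy u | light u ∨ (leaf u ∧ not (hasNbr heavy u))
  ... | true  | _     = ≤-refl
  ... | false | true  = s≤s z≤n
  ... | false | false = z≤n

  charge : Fin n → Fin n → ℕ
  charge u v = if leaf u then (if heavy v then 3 else 0)
               else if heavy u ∨ light u then 0
               else if leaf v then 1 else 2

  charge-leaf-≤3 : ∀ {u} v → leaf u ≡ true → charge u v ≤ 3
  charge-leaf-≤3 {u} v l rewrite l with heavy v
  ... | true  = ≤-refl
  ... | false = z≤n

  charge-leaf-unheavy : ∀ {u v} → leaf u ≡ true → heavy v ≡ false → charge u v ≡ 0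
  charge-leaf-unheavy l h rewrite l | h = refl

  charge-leaf-heavy : ∀ {u v} → leaf u ≡ true → heavy v ≡ true → charge u v ≡ 3
  charge-leaf-heavy l h rewrite l | h = refl

  charge-heavy : ∀ {u} v → heavy u ≡ true → charge u v ≡ 0
  charge-heavy {u} v h rewrite h | heavy⇒nonleaf h = refl

  charge-light : ∀ {u} v → light u ≡ true → charge u v ≡ 0
  charge-light {u} v l rewrite light⇒unheavy l | l | light⇒nonleaf l = refl

  charge-neither-leaf : ∀ {u v} → leaf u ≡ false → heavy u ≡ false → light u ≡ false →
                        leaf v ≡ true → charge u v ≡ 1
  charge-neither-leaf lu hu iu lv rewrite hu | iu | lu | lv = refl

  charge-neither-inner : ∀ {u v} → leaf u ≡ false → heavy u ≡ false → light u ≡ false →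
                         leaf v ≡ false → charge u v ≡ 2
  charge-neither-inner lu hu iu lv rewrite hu | iu | lu | lv = refl

  module _ (covered : StemCovered) where

    italianFun≡0⇒nbrSum≥2 : ∀ {u} → italianFun u ≡ 0 → 2 ≤ nbrSum E italianFun u
    italianFun≡0⇒nbrSum≥2 {u} zero-at-u
      with true-or-false (heavy u) | true-or-false (light u) | true-or-false (leaf u)
    ... | inj₁ hu | _       | _ = contradiction (trans (sym (italianFun-heavy hu)) zero-at-u) λ ()
    ... | inj₂ _  | inj₁ iu | _ = contradiction (trans (sym (italianFun-light iu)) zero-at-u) λ ()
    ... | inj₂ _  | inj₂ _  | inj₁ lu with true-or-false (hasNbr heavy u)
    ...   | inj₂ none = contradiction (trans (sym (italianFun-leaf-alone lu none)) zero-at-u) λ ()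
    ...   | inj₁ some with hasNbr-witness heavy some
    ...     | w , auw , hw = subst (_≤ nbrSum E italianFun u) (italianFun-heavy hw)
                                   (sumOver-≥-term (adj E u) italianFun auw)
    italianFun≡0⇒nbrSum≥2 {u} zero-at-u | inj₂ hu | inj₂ iu | inj₂ lu
      with neither⇒stem lu hu iu
    ... | u-stem@(su , _) with stem-leaf-nbr su | stem-inner-nbr su
    ...   | y , auy , ly | w , auw , lw = begin
      1 + 1                           ≤⟨ +-mono-≤ (≤-reflexive (sym fy≡1)) fw≥1 ⟩
      italianFun y + italianFun w     ≤⟨ sumOver-≥-two-terms (adj E u) italianFun y≢w auy auw ⟩
      nbrSum E italianFun u           ∎
      where
      open ≤-Reasoning
      y≢w : y ≢ w
      y≢w refl = both-true-false ly lw
      fy≡1 : italianFun y ≡ 1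
      fy≡1 = italianFun-leaf-alone ly (hasNbr-none heavy λ z ayz →
               subst (λ x → heavy x ≡ false) (sym (leaf-nbr-unique ly (adj-sym auy) ayz)) hu)
      fw≥1 : 1 ≤ italianFun w
      fw≥1 with true-or-false (heavy w) | true-or-false (light w)
      ... | inj₁ hw | _       = ≤-trans (n≤1+n 1) (≤-reflexive (sym (italianFun-heavy hw)))
      ... | inj₂ _  | inj₁ iw = ≤-reflexive (sym (italianFun-light iw))
      ... | inj₂ hw | inj₂ iw = ⊥-elim (nonlead-stems-nonadjacent u-stem (neither⇒stem lw hw iw) auw)

    italianFun-RDF : ∀ (G : SimpleGraph n) → Subgraph E G → IsRDF 2 G italianFun
    italianFun-RDF G E⊆G = italianFun≤2 , λ u small →
      ≤-trans (italianFun≡0⇒nbrSum≥2 (2*x<2⇒x≡0 small))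
              (≤-trans (sumOver-⊆ italianFun (E⊆G u)) (m≤n+m _ _))

  module _ (noIso : NoIsolated) (noLeafEdge : NoLeafEdge) (covered : StemCovered) where

    sent received : Fin n → ℕ
    sent u = sumOver (adj E u) (charge u)
    received u = sumOver (adj E u) (λ v → charge v u)

    open Heavy covered heavy heavy⇒nonleaf heavy-stem⇒lead

    balance-leaf-covered : ∀ {u} → leaf u ≡ true → hasNbr heavy u ≡ true →
                           4 * italianFun u + sent u ≤ 3 + received u
    balance-leaf-covered {u} lu some rewrite italianFun-leaf-covered lu some = begin
      sent u         ≤⟨ sumOver-≤ (adj E u) 3 (λ v _ → charge-leaf-≤3 v lu) ⟩
      3 * deg u      ≡⟨ cong (3 *_) (leaf⇒deg≡1 lu) ⟩
      3              ≤⟨ m≤m+n 3 _ ⟩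
      3 + received u ∎
      where open ≤-Reasoning

    balance-leaf-alone : ∀ {u} → leaf u ≡ true → hasNbr heavy u ≡ false →
                         4 * italianFun u + sent u ≤ 3 + received u
    balance-leaf-alone {u} lu none with count-witness (adj E u) (noIso u)
    ... | x , aux rewrite italianFun-leaf-alone lu none = begin
      4 + sent u      ≤⟨ +-monoʳ-≤ 4 sends-nothing ⟩
      4 + 0           ≡⟨ cong (3 +_) (sym gift) ⟩
      3 + charge x u  ≤⟨ +-monoʳ-≤ 3 (sumOver-≥-term (adj E u) (λ v → charge v u) aux) ⟩
      3 + received u  ∎
      where
      open ≤-Reasoning
      sends-nothing : sent u ≤ 0
      sends-nothing = sumOver-≤ (adj E u) 0 λ v auv →
                        ≤-reflexive (charge-leaf-unheavy lu (hasNbr-false heavy none auv))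
      unlight : light x ≡ false
      unlight with true-or-false (light x)
      ... | inj₂ ix = ix
      ... | inj₁ ix = contradiction (count-≥1 (leafNbr x) (cong₂ _∧_ (adj-sym aux) lu))
                                    (λ pos → <⇒≢ pos (sym (proj₂ (light-parts ix))))
      gift : charge x u ≡ 1
      gift = charge-neither-leaf (noLeafEdge u x aux lu) (hasNbr-false heavy none aux) unlight lu

    balance-heavy : ∀ {u} → heavy u ≡ true → 4 * italianFun u + sent u ≤ 3 + received u
    balance-heavy {u} hu rewrite italianFun-heavy hu = begin
      8 + sent u                           ≤⟨ +-monoʳ-≤ 8 (sumOver-≤ (adj E u) 0 λ v _ → ≤-reflexive (charge-heavy v hu)) ⟩
      3 + 5                                ≤⟨ +-monoʳ-≤ 3 enough-nbrs ⟩
      3 + (3 * leafDeg u + 2 * innerDeg u) ≤⟨ +-monoʳ-≤ 3 (sumOver-adj-≥ u _ 3 2 from-leaf from-inner) ⟩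
      3 + received u                       ∎
      where
      open ≤-Reasoning
      lu : leaf u ≡ false
      lu = heavy⇒nonleaf hu
      from-leaf : ∀ v → leafNbr u v ≡ true → 3 ≤ charge v u
      from-leaf v e = ≤-reflexive (sym (charge-leaf-heavy (leafNbr⇒leaf e) hu))
      from-inner : ∀ v → innerNbr u v ≡ true → 2 ≤ charge v u
      from-inner v e = ≤-reflexive (sym (charge-neither-inner lv unheavy (stem⇒unlight sv) lu))
        where
        auv : adj E u v ≡ true
        auv = ∧-conicalˡ (adj E u v) _ e
        lv : leaf v ≡ false
        lv = innerNbr⇒nonleaf e
        sv : stem v ≡ true
        sv = heavy-inner-nbr-stem hu auv lv
        unheavy : heavy v ≡ false
        unheavy with true-or-false (heavy v)
        ... | inj₁ hv = ⊥-elim (heavy-nonadjacent hu hv auv)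
        ... | inj₂ hv = hv
      enough-nbrs : 5 ≤ 3 * leafDeg u + 2 * innerDeg u
      enough-nbrs with heavy-cases hu
      ... | inj₂ lead = ≤-reflexive (sym (cong₂ (λ l i → 3 * l + 2 * i)
                          (stem-leafDeg (leadStem⇒stem lead)) (stem-innerDeg (leadStem⇒stem lead))))
      ... | inj₁ (unstem , pos) =
        3l+2i≥5 pos (subst (2 ≤_) (deg≡leafDeg+innerDeg u) (nonleaf⇒deg≥2 noIso lu))
                λ (l≡1 , i≡1) → both-true-false (stem-intro l≡1 i≡1) unstem

    balance-light : ∀ {u} → light u ≡ true → 4 * italianFun u + sent u ≤ 3 + received u
    balance-light {u} iu with count-witness (adj E u) (noIso u)
    ... | v , auv rewrite italianFun-light iu = begin
      4 + sent u      ≤⟨ +-monoʳ-≤ 4 (sumOver-≤ (adj E u) 0 λ w _ → ≤-reflexive (charge-light w iu)) ⟩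
      4 + 0           ≤⟨ n≤1+n 4 ⟩
      3 + 2           ≡⟨ cong (3 +_) (sym gift) ⟩
      3 + charge v u  ≤⟨ +-monoʳ-≤ 3 (sumOver-≥-term (adj E u) (λ w → charge w u) auv) ⟩
      3 + received u  ∎
      where
      open ≤-Reasoning
      unstem-u : stem u ≡ false
      unstem-u = proj₁ (light-parts iu)
      lu : leaf u ≡ false
      lu = light⇒nonleaf iu
      lv : leaf v ≡ false
      lv with true-or-false (leaf v)
      ... | inj₂ lv = lv
      ... | inj₁ lv = contradiction (count-≥1 (leafNbr u) (cong₂ _∧_ auv lv))
                                    (λ pos → <⇒≢ pos (sym (proj₂ (light-parts iu))))
      sv : stem v ≡ true
      sv with covered u v auv lu lv
      ... | inj₁ su = ⊥-elim (both-true-false su unstem-u)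
      ... | inj₂ sv = sv
      hv : heavy v ≡ false
      hv with true-or-false (heavy v)
      ... | inj₂ hv = hv
      ... | inj₁ hv = ⊥-elim (both-true-false stem-u unstem-u)
        where
        stem-u : stem u ≡ true
        stem-u = proj₁ (leadStem-partner (heavy-stem⇒lead hv sv) (adj-sym auv) lu)
      gift : charge v u ≡ 2
      gift = charge-neither-inner lv hv (stem⇒unlight sv) lu

    balance-neither : ∀ {u} → leaf u ≡ false → heavy u ≡ false → light u ≡ false →
                      4 * italianFun u + sent u ≤ 3 + received u
    balance-neither {u} lu hu iu rewrite italianFun-neither lu hu iu = begin
      sent u                            ≤⟨ sumOver-adj-≤ u (charge u) 1 2 to-leaf to-inner ⟩
      1 * leafDeg u + 2 * innerDeg u    ≡⟨ cong₂ (λ l i → 1 * l + 2 * i) (stem-leafDeg su) (stem-innerDeg su) ⟩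
      3                                 ≤⟨ m≤m+n 3 _ ⟩
      3 + received u                    ∎
      where
      open ≤-Reasoning
      to-leaf : ∀ v → leafNbr u v ≡ true → charge u v ≤ 1
      to-leaf v e = ≤-reflexive (charge-neither-leaf lu hu iu (leafNbr⇒leaf e))
      to-inner : ∀ v → innerNbr u v ≡ true → charge u v ≤ 2
      to-inner v e = ≤-reflexive (charge-neither-inner lu hu iu (innerNbr⇒nonleaf e))
      su : stem u ≡ true
      su = proj₁ (neither⇒stem lu hu iu)

    balance : ∀ u → 4 * italianFun u + sent u ≤ 3 + received u
    balance u with true-or-false (heavy u) | true-or-false (light u) | true-or-false (leaf u)
    ... | inj₁ hu | _       | _       = balance-heavy hu
    ... | inj₂ _  | inj₁ iu | _       = balance-light iu
    ... | inj₂ hu | inj₂ iu | inj₂ lu = balance-neither lu hu iu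
    ... | inj₂ _  | inj₂ _  | inj₁ lu with true-or-false (hasNbr heavy u)
    ...   | inj₁ some = balance-leaf-covered lu some
    ...   | inj₂ none = balance-leaf-alone lu none

    italianFun-weight : 4 * weight italianFun ≤ 3 * n
    italianFun-weight = discharging italianFun charge 4 3 balance

-- Pruning to a stem-covered spanning subgraph

module _ {n : ℕ} (E : SimpleGraph n) where

  open Degrees E

  removable : Fin n → Fin n → Bool
  removable u w = adj E u w ∧ (not (leaf u) ∧ (not (leaf w) ∧ (not (stem u) ∧ not (stem w))))

  record Removable (u w : Fin n) : Set where
    field
      adjacent  : adj E u w ≡ true
      nonleaf-u : leaf u ≡ false
      nonleaf-w : leaf w ≡ false
      unstem-u  : stem u ≡ false
      unstem-w  : stem w ≡ false

  removable⇒Removable : ∀ {u w} → removable u w ≡ true → Removable u w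
  removable⇒Removable {u} {w} r with by-cases {adj E u w} {leaf u} {leaf w} {stem u} {stem w} r
    where
    by-cases : ∀ {a lu lw su sw} → (a ∧ (not lu ∧ (not lw ∧ (not su ∧ not sw)))) ≡ true →
               a ≡ true × lu ≡ false × lw ≡ false × su ≡ false × sw ≡ false
    by-cases {true} {false} {false} {false} {false} _ = refl , refl , refl , refl , refl
  ... | a , lu , lw , su , sw = record
    { adjacent = a ; nonleaf-u = lu ; nonleaf-w = lw ; unstem-u = su ; unstem-w = sw }

module EdgeRemoval {n : ℕ} (E : SimpleGraph n) (u w : Fin n) where

  endpoint : Fin n → Bool
  endpoint z = does (z ≟ᶠ u) ∨ does (z ≟ᶠ w)

  -- As E has no loops, the only edge joining two endpoints is uw.
  E′ : SimpleGraph n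
  E′ = record
    { adj    = λ x y → adj E x y ∧ not (endpoint x ∧ endpoint y)
    ; sym    = λ x y → cong₂ (λ a b → a ∧ not b) (SimpleGraph.sym E x y)
                                                   (∧-comm (endpoint x) (endpoint y))
    ; irrefl = λ x → cong (_∧ not (endpoint x ∧ endpoint x)) (SimpleGraph.irrefl E x)
    }

  open Degrees E
  module ′ = Degrees E′

  E′⊆E : Subgraph E′ E
  E′⊆E x y = ∧-conicalˡ (adj E x y) _

  adj′-between-endpoints : ∀ {x y} → endpoint x ≡ true → endpoint y ≡ true → adj E′ x y ≡ false
  adj′-between-endpoints {x} {y} ex ey rewrite ex | ey = ∧-zeroʳ (adj E x y)

  adj′-to-away : ∀ x {y} → endpoint y ≡ false → adj E′ x y ≡ adj E x y
  adj′-to-away x {y} ey rewrite ey | ∧-zeroʳ (endpoint x) = ∧-identityʳ (adj E x y)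

  adj′-from-away : ∀ {x} y → endpoint x ≡ false → adj E′ x y ≡ adj E x y
  adj′-from-away {x} y ex rewrite ex = ∧-identityʳ (adj E x y)

  deg′≤deg : ∀ x → ′.deg x ≤ deg x
  deg′≤deg x = sumOver-⊆ (λ _ → 1) (E′⊆E x)

  deg′-away : ∀ {x} → endpoint x ≡ false → ′.deg x ≡ deg x
  deg′-away ex = sumFin-cong (λ y → cong (λ b → if b then 1 else 0) (adj′-from-away y ex))

  leaf-away : ∀ {x} → endpoint x ≡ false → ′.leaf x ≡ true → leaf x ≡ true
  leaf-away ex l′x = trans (cong (_≡ᵇ 1) (sym (deg′-away ex))) l′x

  endpoint-cases : ∀ {z} → endpoint z ≡ true → z ≡ u ⊎ z ≡ w
  endpoint-cases {z} e with z ≟ᶠ u | z ≟ᶠ w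
  ... | yes z≡u | _       = inj₁ z≡u
  ... | no _    | yes z≡w = inj₂ z≡w

  endpoint-away : ∀ {z} → z ≢ u → z ≢ w → endpoint z ≡ false
  endpoint-away {z} z≢u z≢w rewrite dec-false (z ≟ᶠ u) z≢u | dec-false (z ≟ᶠ w) z≢w = refl

  endpoint-u : endpoint u ≡ true
  endpoint-u rewrite dec-true (u ≟ᶠ u) refl = refl

  endpoint-w : endpoint w ≡ true
  endpoint-w rewrite dec-true (w ≟ᶠ w) refl = ∨-zeroʳ (does (w ≟ᶠ u))

  module Endpoint (z z̄ : Fin n) (azz̄ : adj E z z̄ ≡ true) (ez : endpoint z ≡ true) (ez̄ : endpoint z̄ ≡ true)
                  (only : ∀ {y} → endpoint y ≡ true → y ≡ z ⊎ y ≡ z̄) where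

    deg′+1 : ′.deg z + 1 ≡ deg z
    deg′+1 = begin
      ′.deg z + 1                                  ≡⟨ cong (λ b → ′.deg z + (if b then 1 else 0)) azz̄ ⟨
      ′.deg z + (if adj E z z̄ then 1 else 0)       ≡⟨ sumFin-update (λ y → if adj E′ z y then 1 else 0)
                                                                    (λ y → if adj E z y then 1 else 0) z̄ agree ⟩
      deg z + (if adj E′ z z̄ then 1 else 0)        ≡⟨ cong (λ b → deg z + (if b then 1 else 0))
                                                          (adj′-between-endpoints ez ez̄) ⟩
      deg z + 0                                    ≡⟨ +-identityʳ (deg z) ⟩
      deg z                                        ∎
      where
      open ≡-Reasoning
      agree : ∀ y → y ≢ z̄ → (if adj E′ z y then 1 else 0) ≡ (if adj E z y then 1 else 0)
      agree y y≢z̄ with true-or-false (endpoint y)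
      ... | inj₂ ey = cong (λ b → if b then 1 else 0) (adj′-to-away z ey)
      ... | inj₁ ey with only ey
      ...   | inj₂ y≡z̄ = contradiction y≡z̄ y≢z̄
      ...   | inj₁ refl = cong (λ b → if b then 1 else 0)
                               (trans (SimpleGraph.irrefl E′ y) (sym (SimpleGraph.irrefl E y)))

    leaf-edge-at-endpoint : leaf z̄ ≡ false → stem z ≡ false →
      ∀ {t} → adj E′ z t ≡ true → ′.leaf z ≡ true → ′.leaf t ≡ true → ⊥
    leaf-edge-at-endpoint lz̄ unstem {t} a′zt l′z l′t = both-true-false stem-z unstem
      where
      et : endpoint t ≡ false
      et with true-or-false (endpoint t)
      ... | inj₁ et = ⊥-elim (both-true-false a′zt (adj′-between-endpoints ez et))
      ... | inj₂ et = et
      lt : leaf t ≡ true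
      lt = leaf-away et l′t
      deg-z : deg z ≡ 2
      deg-z = trans (sym deg′+1) (cong (_+ 1) (′.leaf⇒deg≡1 l′z))
      stem-z : stem z ≡ true
      stem-z = deg2-stem deg-z (E′⊆E z t a′zt) lt azz̄ lz̄

  module _ (r : Removable E u w) where

    open Removable r

    module AtU = Endpoint u w adjacent endpoint-u endpoint-w endpoint-cases
    module AtW = Endpoint w u (adj-sym adjacent) endpoint-w endpoint-u (swap ∘ endpoint-cases)

    deg′-endpoint : ∀ {z} → endpoint z ≡ true → ′.deg z + 1 ≡ deg z
    deg′-endpoint {z} ez with endpoint-cases {z} ez
    ... | inj₁ refl = AtU.deg′+1
    ... | inj₂ refl = AtW.deg′+1

    no-leaf-edge-at-endpoint : ∀ {z t} → endpoint z ≡ true → adj E′ z t ≡ true →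
                               ′.leaf z ≡ true → ′.leaf t ≡ true → ⊥
    no-leaf-edge-at-endpoint {z} ez with endpoint-cases {z} ez
    ... | inj₁ refl = AtU.leaf-edge-at-endpoint nonleaf-w unstem-u
    ... | inj₂ refl = AtW.leaf-edge-at-endpoint nonleaf-u unstem-w

    edgeCount-decreases : sumFin ′.deg < sumFin deg
    edgeCount-decreases =
      sumFin-mono-< deg′≤deg u (≤-reflexive (trans (+-comm 1 (′.deg u)) (deg′-endpoint endpoint-u)))

    noIsolated′ : NoIsolated → ′.NoIsolated
    noIsolated′ noIso x with true-or-false (endpoint x)
    ... | inj₂ ex = subst (0 <_) (sym (deg′-away ex)) (noIso x)
    ... | inj₁ ex =
      +-cancelʳ-≤ 1 1 (′.deg x) (subst (2 ≤_) (sym (deg′-endpoint ex)) (nonleaf⇒deg≥2 noIso nonleaf-x))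
      where
      nonleaf-x : leaf x ≡ false
      nonleaf-x with endpoint-cases {x} ex
      ... | inj₁ refl = nonleaf-u
      ... | inj₂ refl = nonleaf-w

    noLeafEdge′ : NoLeafEdge → ′.NoLeafEdge
    noLeafEdge′ noLE x y a′xy l′x with true-or-false (′.leaf y)
    ... | inj₂ l′y = l′y
    ... | inj₁ l′y with true-or-false (endpoint x) | true-or-false (endpoint y)
    ...   | inj₁ ex | _       = ⊥-elim (no-leaf-edge-at-endpoint ex a′xy l′x l′y)
    ...   | inj₂ _  | inj₁ ey = ⊥-elim (no-leaf-edge-at-endpoint ey (′.adj-sym a′xy) l′y l′x)
    ...   | inj₂ ex | inj₂ ey = ⊥-elim (both-true-false (leaf-away ey l′y) (noLE x y (E′⊆E x y a′xy) (leaf-away ex l′x)))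

record StemCoveredSubgraph {n : ℕ} (G : SimpleGraph n) : Set where
  field
    graph       : SimpleGraph n
    ⊆G          : Subgraph graph G
    noIsolated  : Degrees.NoIsolated graph
    noLeafEdge  : Degrees.NoLeafEdge graph
    stemCovered : Degrees.StemCovered graph

prune : ∀ {n} (E : SimpleGraph n) → Acc _<_ (sumFin (Degrees.deg E)) →
        Degrees.NoIsolated E → Degrees.NoLeafEdge E → StemCoveredSubgraph E
prune E (acc smaller) noIso noLE with any? (λ u → any? (λ w → removable E u w ≟ᵇ true))
... | yes (u , w , r) = record
  { graph = graph ; ⊆G = λ x y → E′⊆E x y ∘ ⊆G x y
  ; noIsolated = noIsolated ; noLeafEdge = noLeafEdge ; stemCovered = stemCovered }
  where
  open EdgeRemoval E u w
  removable-uw : Removable E u w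
  removable-uw = removable⇒Removable E r
  open StemCoveredSubgraph (prune E′ (smaller (edgeCount-decreases removable-uw))
                                    (noIsolated′ removable-uw noIso) (noLeafEdge′ removable-uw noLE))
... | no none = record
  { graph = E ; ⊆G = λ _ _ e → e ; noIsolated = noIso ; noLeafEdge = noLE ; stemCovered = covered }
  where
  open Degrees E
  covered : StemCovered
  covered u v auv lu lv with true-or-false (stem u) | true-or-false (stem v)
  ... | inj₁ su | _       = inj₁ su
  ... | inj₂ _  | inj₁ sv = inj₂ sv
  ... | inj₂ su | inj₂ sv = ⊥-elim (none (u , v , removable-uv))
    where
    removable-uv : removable E u v ≡ true
    removable-uv rewrite auv | lu | lv | su | sv = refl

-- Connected graphs on at least three vertices

third-vertex : ∀ {n} → 3 ≤ n → (u w : Fin n) → ∃ λ z → z ≢ u × z ≢ w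
third-vertex (s≤s (s≤s (s≤s _))) zero          zero          = suc zero       , (λ ()) , (λ ())
third-vertex (s≤s (s≤s (s≤s _))) zero          (suc zero)    = suc (suc zero) , (λ ()) , (λ ())
third-vertex (s≤s (s≤s (s≤s _))) zero          (suc (suc _)) = suc zero       , (λ ()) , (λ ())
third-vertex (s≤s (s≤s (s≤s _))) (suc zero)    zero          = suc (suc zero) , (λ ()) , (λ ())
third-vertex (s≤s (s≤s (s≤s _))) (suc (suc _)) zero          = suc zero       , (λ ()) , (λ ())
third-vertex (s≤s (s≤s (s≤s _))) (suc _)       (suc _)       = zero           , (λ ()) , (λ ())

walk-exits : ∀ {n} (G : SimpleGraph n) (S : Fin n → Bool) {x z} → Reach G x z →
             S x ≡ true → S z ≡ false → ∃₂ λ p q → S p ≡ true × S q ≡ false × adj G p q ≡ true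
walk-exits G S here                 Sx Sz = ⊥-elim (both-true-false Sx Sz)
walk-exits G S (step {v = v} axv r) Sx Sz with true-or-false (S v)
... | inj₁ Sv = walk-exits G S r Sv Sz
... | inj₂ Sv = _ , v , Sx , Sv , axv

module _ {n : ℕ} (G : SimpleGraph n) (n≥3 : 3 ≤ n) (conn : Connected G) where

  open Degrees G

  connected⇒noIsolated : NoIsolated
  connected⇒noIsolated u with third-vertex n≥3 u u
  ... | z , z≢u , _ = first-step (conn u z)
    where
    first-step : Reach G u z → 0 < deg u
    first-step here           = contradiction refl z≢u
    first-step (step auv _)   = count-≥1 (adj G u) auv

  leaf-pair-disconnected : ∀ {u w} → adj G u w ≡ true → leaf u ≡ true → leaf w ≡ true → ⊥
  leaf-pair-disconnected {u} {w} auw lu lw with third-vertex n≥3 u w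
  ... | z , z≢u , z≢w = escape (walk-exits G endpoint (conn u z) endpoint-u (endpoint-away z≢u z≢w))
    where
    open EdgeRemoval G u w using (endpoint; endpoint-u; endpoint-w; endpoint-away; endpoint-cases)
    is-endpoint : Fin n → Set
    is-endpoint x = endpoint x ≡ true
    escape : (∃₂ λ p q → endpoint p ≡ true × endpoint q ≡ false × adj G p q ≡ true) → ⊥
    escape (p , q , ep , eq , apq) with endpoint-cases {p} ep
    ... | inj₁ refl = both-true-false (subst is-endpoint (sym (leaf-nbr-unique lu auw apq)) endpoint-w) eq
    ... | inj₂ refl = both-true-false (subst is-endpoint (sym (leaf-nbr-unique lw (adj-sym auw) apq)) endpoint-u) eq

  connected⇒noLeafEdge : NoLeafEdge
  connected⇒noLeafEdge u w auw lu with true-or-false (leaf w)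
  ... | inj₁ lw = ⊥-elim (leaf-pair-disconnected auw lu lw)
  ... | inj₂ lw = lw

  stemCoveredSubgraph : StemCoveredSubgraph G
  stemCoveredSubgraph = prune G (<-wellFounded _) connected⇒noIsolated connected⇒noLeafEdge

  open StemCoveredSubgraph stemCoveredSubgraph
  open Italian graph using (italianFun; italianFun-RDF; italianFun-weight)
  open Roman graph using (romanFun; romanFun-SRDF; romanFun-weight)

  italianFun-2RDF : IsRDF 2 G italianFun
  italianFun-2RDF = italianFun-RDF stemCovered G ⊆G

  romanFun-2SRDF : IsSRDF 2 G romanFun
  romanFun-2SRDF = romanFun-SRDF stemCovered G ⊆G

  italianFun-bound : 4 * weight italianFun ≤ 3 * n
  italianFun-bound = italianFun-weight noIsolated noLeafEdge stemCovered

  romanFun-bound : 5 * weight romanFun ≤ 4 * n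
  romanFun-bound = romanFun-weight noIsolated noLeafEdge stemCovered

  even-bounds : ∀ k → 2 ∣ k → ∀ f g → IsGammaFun k G f → IsGammaSFun k G g →
                (8 * weight f ≤ 3 * k * n) × (5 * weight g ≤ 2 * k * n)
  even-bounds .(c * 2) (divides c refl) f g γf γg =
    γ-even-bound {G = G} italianFun {c = c} italianFun-2RDF italianFun-bound γf ,
    γˢ-even-bound {G = G} romanFun {c = c} romanFun-2SRDF romanFun-bound γg

  odd-bounds : ∀ k → 2 ≤ k → ¬ 2 ∣ k → ∀ f g → IsGammaFun k G f → IsGammaSFun k G g →
               (8 * weight f ≤ (3 * k + 5) * n) × (5 * weight g ≤ 2 * (k + 1) * n)
  odd-bounds k k≥2 k-odd f g γf γg with odd-half k k-odd
  ... | c , refl =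
    γ-odd-bound {G = G} italianFun {c = c} (c≥1 c k≥2) italianFun-2RDF italianFun-bound γf ,
    γˢ-odd-bound {G = G} romanFun {c = c} romanFun-2SRDF romanFun-bound γg
    where
    c≥1 : ∀ c → 2 ≤ c * 2 + 1 → 1 ≤ c
    c≥1 zero    (s≤s ())
    c≥1 (suc _) _ = s≤s z≤n

theorem2p3 : ∀ (n : ℕ) (G : SimpleGraph n) → Connected G →
    -- (1)
    ((c k : ℕ) → 1 ≤ c → 1 ≤ k →
      (∀ (f g : Fin n → ℕ) → IsGammaFun (c * k) G g → IsGammaFun k G f →
         weight g ≤ c * weight f) ×
      (∀ (f g : Fin n → ℕ) → IsGammaSFun (c * k) G g → IsGammaSFun k G f →
         weight g ≤ c * weight f)) ×
    -- (2)
    ((c k : ℕ) → 1 ≤ c → 1 ≤ k →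
      ∀ (f g : Fin n → ℕ) → IsGammaFun k G f → IsGammaFun (c * k + 1) G g →
        (weight g ≤ c * weight f + sumRange (suc (k / 2)) (cardV f)) ×
        (c * weight f + sumRange (suc (k / 2)) (cardV f) ≤ c * weight f + n)) ×
    -- (3)
    ((c k : ℕ) → 1 ≤ c → 1 ≤ k →
      ∀ (f g : Fin n → ℕ) → IsGammaSFun k G f → IsGammaSFun (c * k + 1) G g →
        (weight g + cardV f 0 ≤ c * weight f + n) ×
        (c * weight f + n ≤ (c + 1) * weight f + cardV f 0)) ×
    -- (4)
    (3 ≤ n → ∀ (k : ℕ) → 2 ≤ k →
      (2 ∣ k → ∀ (f h : Fin n → ℕ) → IsGammaFun k G f → IsGammaSFun k G h →
         (8 * weight f ≤ 3 * k * n) × (5 * weight h ≤ 2 * k * n)) ×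
      (¬ (2 ∣ k) → ∀ (f h : Fin n → ℕ) → IsGammaFun k G f → IsGammaSFun k G h →
         (8 * weight f ≤ (3 * k + 5) * n) × (5 * weight h ≤ 2 * (k + 1) * n)))
theorem2p3 n G conn =
    (λ c k _ _ → (λ f g γg γf → γ-scale {G = G} {c = c} γg (proj₁ γf)) ,
                 (λ f g γg γf → γˢ-scale {G = G} {c = c} γg (proj₁ γf)))
  , (λ c k c≥1 _ f g γf γg → γ-liftSmall {G = G} {c = c} c≥1 γg (proj₁ γf) ,
                              +-monoʳ-≤ (c * weight f) (sumRange-cardV≤n f (suc (k / 2))))
  , (λ c k _ k≥1 f g γf γg → γˢ-liftPositive-cardV {G = G} {c = c} k≥1 γg (proj₁ γf) , scaled+n≤ c f)
  , (λ n≥3 k k≥2 → even-bounds G n≥3 conn k , odd-bounds G n≥3 conn k k≥2)
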